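{- Let $m \geq 1$ and $n \geq 1$ be integers and let $K_n$ be the complete graph on $n$ vertices. Then \[ \chi_m(K_n,-1) = \sum_{k=1}^{n} (-1)^k\, k!\, B_{n,k}(1_m). \]
   Context: For a graph $G$ and positive integer $\lambda$, $\chi_m(G,\lambda)$ is the number of colorings of the vertices of $G$ with $\lambda$ colors such that every vertex $v$ has at most $m-1$ neighbors having the same color as $v$; this is a polynomial in $\lambda$ (the degree-chromatic polynomial), and $\chi_m(G,-1)$ is its value at $\lambda=-1$. Bell polynomials: for integers $n,k \geq 0$, $B_{n,k}(x_1,x_2,\ldots,x_{n-k+1}) = \sum_{\alpha} \frac{n!}{\alpha_1!\cdots\alpha_{n-k+1}!}\prod_{i}\left(\frac{x_i}{i!}\right)^{\alpha_i}$, the sum over all sequences $\alpha$ of nonnegative integers with $\sum_i \alpha_i = k$ and $\sum_i i\,\alpha_i = n$. $1_m$ denotes the sequence $(x_1,x_2,\ldots)$ with $x_i = 1$ for $1\le i\le m$ and $x_i=0$ for $i>m$. -}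

module Defs where

open import Data.Nat as ℕ using (ℕ; zero; suc; _∸_; _<ᵇ_; _!; NonZero)
open import Data.Nat.Properties using (m*n≢0; m^n≢0; _!≢0)
open import Data.Nat.DivMod using (_/_)
open import Data.Integer as ℤ using (ℤ; +_)
open import Data.Fin using (Fin)
import Data.Fin.Properties as FinP
open import Data.Bool using (Bool; true; false; _∧_; not; if_then_else_)
open import Data.Product using (_×_; _,_)
open import Data.List using (List; []; _∷_; map; concatMap; filterᵇ; length; foldr; allFin; upTo)
open import Relation.Nullary.Decidable using (⌊_⌋)

Graph : ℕ → Set
Graph n = Fin n → Fin n → Bool

complete : (n : ℕ) → Graph n
complete n u v = not ⌊ u FinP.≟ v ⌋

extend : ∀ {n l} → Fin l → (Fin n → Fin l) → Fin (suc n) → Fin l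
extend a c Fin.zero    = a
extend a c (Fin.suc i) = c i

allColourings : (n l : ℕ) → List (Fin n → Fin l)
allColourings zero    l = (λ ()) ∷ []
allColourings (suc n) l =
  concatMap (λ c → map (λ a → extend a c) (allFin l)) (allColourings n l)

monoDeg : ∀ {n l} → Graph n → (Fin n → Fin l) → Fin n → ℕ
monoDeg {n} G c v = length (filterᵇ (λ u → G u v ∧ ⌊ c u FinP.≟ c v ⌋) (allFin n))

isGood : ∀ {n l} → ℕ → Graph n → (Fin n → Fin l) → Bool
isGood {n} m G c = foldr (λ v b → (monoDeg G c v <ᵇ m) ∧ b) true (allFin n)

χ : (m : ℕ) → ∀ {n} → Graph n → ℕ → ℕ
χ m {n} G l = length (filterᵇ (isGood m G) (allColourings n l))

-- Integer polynomials as coefficient lists (constant term first).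

Poly : Set
Poly = List ℤ

eval : Poly → ℤ → ℤ
eval []       x = + 0
eval (a ∷ as) x = a ℤ.+ x ℤ.* eval as x

-- Bell polynomials B_{n,k}(x_1, ..., x_{n-k+1}).
-- Sum over sequences α = (α_1, ..., α_{n-k+1}) of naturals with
-- Σ α_i = k and Σ i α_i = n of
--   n! / (α_1! ⋯ α_{n-k+1}!) · Π (x_i / i!)^{α_i}
-- = [ n! / (Π α_i! · Π (i!)^{α_i}) ] · Π x_i^{α_i}.
-- The bracket is always a natural number (it counts set partitions of
-- type α), so it is computed in ℕ by (exact) division.

boundedSeqs : ℕ → ℕ → List (List ℕ)
boundedSeqs zero    b = [] ∷ []
boundedSeqs (suc L) b =
  concatMap (λ s → map (λ a → a ∷ s) (upTo (suc b))) (boundedSeqs L b)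

indexedFrom : ℕ → List ℕ → List (ℕ × ℕ)
indexedFrom i []       = []
indexedFrom i (a ∷ as) = (i , a) ∷ indexedFrom (suc i) as

sumα : List ℕ → ℕ
sumα = foldr ℕ._+_ 0

weightα : List ℕ → ℕ
weightα α = foldr (λ { (i , a) r → i ℕ.* a ℕ.+ r }) 0 (indexedFrom 1 α)

denomFrom : ℕ → List ℕ → ℕ
denomFrom i []       = 1
denomFrom i (a ∷ as) = (a !) ℕ.* ((i !) ℕ.^ a) ℕ.* denomFrom (suc i) as

denomFrom-nonZero : ∀ i α → NonZero (denomFrom i α)
denomFrom-nonZero i []       = _
denomFrom-nonZero i (a ∷ as) =
  m*n≢0 ((a !) ℕ.* ((i !) ℕ.^ a)) (denomFrom (suc i) as)
    {{m*n≢0 (a !) ((i !) ℕ.^ a) {{a !≢0}} {{m^n≢0 (i !) a {{i !≢0}}}}}}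
    {{denomFrom-nonZero (suc i) as}}

coeffα : ℕ → List ℕ → ℕ
coeffα n α = (n !) / denomFrom 1 α
  where instance _ = denomFrom-nonZero 1 α

monoFrom : ℕ → (ℕ → ℤ) → List ℕ → ℤ
monoFrom i x []       = + 1
monoFrom i x (a ∷ as) = (x i ℤ.^ a) ℤ.* monoFrom (suc i) x as

-- B_{n,k}(x_1, x_2, ...), where x : ℕ → ℤ gives x_i (x 0 is unused)
bell : ℕ → ℕ → (ℕ → ℤ) → ℤ
bell n k x =
  foldr ℤ._+_ (+ 0)
    (map (λ α → (+ coeffα n α) ℤ.* monoFrom 1 x α)
      (filterᵇ (λ α → (sumα α ℕ.≡ᵇ k) ∧ (weightα α ℕ.≡ᵇ n))
        (boundedSeqs (n ∸ k ℕ.+ 1) k)))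

one : ℕ → ℕ → ℤ
one m i = if i ℕ.≤ᵇ m then + 1 else + 0

sumFrom1 : ℕ → (ℕ → ℤ) → ℤ
sumFrom1 zero    f = + 0
sumFrom1 (suc n) f = sumFrom1 n f ℤ.+ f (suc n)

sign : ℕ → ℤ
sign k = (ℤ.- (+ 1)) ℤ.^ k

{-# OPTIONS --safe #-}
module Submission where

-- In K_n a vertex has exactly as many neighbours of its own colour as its colour class has other
-- members, so χ_m(K_n, l) counts the maps from the n vertices to l colours whose fibres have at
-- most m elements. Choosing the set of k colours actually used, χ_m(K_n, l) = Σ_k C(l, k) E_k(n),
-- where E_k(n) counts the ordered partitions of the vertices into k nonempty blocks of size at most m.
-- Grouping ordered partitions by their type α (α_j blocks of size j) gives E_k(n) = k! B_{n,k}(1_m);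
-- the identity is proved by induction on the smallest block size, peeling off the blocks of that size.
-- Hence χ_m(K_n, l) = Σ_k B_{n,k}(1_m) l(l-1)⋯(l-k+1), a polynomial in l whose value at -1 is
-- Σ_k (-1)^k k! B_{n,k}(1_m), because (-1)(-2)⋯(-k) = (-1)^k k!.

open import Defs

module Counting where

  open import Data.Bool using (Bool; true; false; _∧_; not; T)
  open import Data.Bool.Properties using (T-∧)
  open import Data.Empty using (⊥-elim)
  open import Data.Fin as Fin using (Fin; toℕ)
  open import Data.Fin.Properties using (toℕ<n)
  import Data.Fin.Properties as FinP
  open import Data.List using (List; []; _∷_; map; _++_; concatMap; filterᵇ; length; tabulate; applyUpTo; foldr; upTo; allFin)
  open import Data.List.Properties using (map-++; map-∘; map-cong)
  open import Data.Nat using (ℕ; zero; suc; _+_; _*_; _∸_; _^_; _≤_; _<_; z≤n; s≤s; _!; _≤ᵇ_; _<ᵇ_; _≡ᵇ_; _≤?_)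
  open import Data.Nat.Combinatorics
    using (_C_; k>n⇒nCk≡0; nCk+nC[k+1]≡[n+1]C[k+1]; nCk≡n!/k![n-k]!; k![n∸k]!∣n!; [n-k]*[n-k-1]!≡[n-k]!)
  open import Data.Nat.DivMod using (_/_; m/n*n≡m; m*n/n≡m)
  open import Data.Nat.ListAction using (sum)
  open import Data.Nat.ListAction.Properties using (sum-++)
  open import Data.Nat.Properties
  open import Data.Nat.Tactic.RingSolver using (solve-∀)
  open import Data.Product using (_×_; _,_; proj₁; proj₂)
  open import Function using (_∘_)
  open import Function.Bundles using (Equivalence)
  open import Relation.Binary.PropositionalEquality
  open import Relation.Nullary using (¬_; yes; no)
  open import Relation.Nullary.Decidable using (⌊_⌋; ⌊⌋-map′; isYes≗does; dec-true; dec-false)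
  open ≡-Reasoning
  open import Algebra.Properties.Semiring.Sum +-*-semiring
    using (∑-distrib-+; ∑-comm; *-distribˡ-sum; sum-cong-≗; sum-replicate-zero)
    renaming (sum to ∑)

  𝟙 : Bool → ℕ
  𝟙 true  = 1
  𝟙 false = 0

  𝟙-∧ : ∀ a b → 𝟙 (a ∧ b) ≡ 𝟙 a * 𝟙 b
  𝟙-∧ true  b = sym (+-identityʳ (𝟙 b))
  𝟙-∧ false b = refl

  𝟙-T : ∀ {b} → T b → 𝟙 b ≡ 1
  𝟙-T {true} _ = refl

  𝟙-¬T : ∀ {b} → ¬ T b → 𝟙 b ≡ 0
  𝟙-¬T {true}  ¬b = ⊥-elim (¬b _)
  𝟙-¬T {false} _  = refl

  ≤ᵇ-suc : ∀ i j → (suc i ≤ᵇ suc j) ≡ (i ≤ᵇ j)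
  ≤ᵇ-suc zero    j = refl
  ≤ᵇ-suc (suc i) j = refl

  𝟙[i≤ᵇj]≡𝟙[i≡ᵇj]+𝟙[1+i≤ᵇj] : ∀ i j → 𝟙 (i ≤ᵇ j) ≡ 𝟙 (i ≡ᵇ j) + 𝟙 (suc i ≤ᵇ j)
  𝟙[i≤ᵇj]≡𝟙[i≡ᵇj]+𝟙[1+i≤ᵇj] zero    zero    = refl
  𝟙[i≤ᵇj]≡𝟙[i≡ᵇj]+𝟙[1+i≤ᵇj] zero    (suc j) = refl
  𝟙[i≤ᵇj]≡𝟙[i≡ᵇj]+𝟙[1+i≤ᵇj] (suc i) zero    = refl
  𝟙[i≤ᵇj]≡𝟙[i≡ᵇj]+𝟙[1+i≤ᵇj] (suc i) (suc j) rewrite ≤ᵇ-suc i j | ≤ᵇ-suc (suc i) j =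
    𝟙[i≤ᵇj]≡𝟙[i≡ᵇj]+𝟙[1+i≤ᵇj] i j

  𝟙[i≡ᵇj]*fj≡𝟙[i≡ᵇj]*fi : ∀ i j (f : ℕ → ℕ) → 𝟙 (i ≡ᵇ j) * f j ≡ 𝟙 (i ≡ᵇ j) * f i
  𝟙[i≡ᵇj]*fj≡𝟙[i≡ᵇj]*fi i j f with i ≡ᵇ j in i≡ᵇj
  ... | false = refl
  ... | true  = cong (λ k → 1 * f k) (sym (≡ᵇ⇒≡ i j (subst T (sym i≡ᵇj) _)))

  ≡ᵇ-+-split : ∀ a y k → (a + y ≡ᵇ k) ≡ ((a ≤ᵇ k) ∧ (y ≡ᵇ k ∸ a))
  ≡ᵇ-+-split zero    y k       = refl
  ≡ᵇ-+-split (suc a) y zero    = refl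
  ≡ᵇ-+-split (suc a) y (suc k) = trans (≡ᵇ-+-split a y k) (cong (_∧ (y ≡ᵇ k ∸ a)) (sym (≤ᵇ-suc a k)))

  𝟙-∧-interchange : ∀ p q r s → 𝟙 ((p ∧ q) ∧ (r ∧ s)) ≡ 𝟙 p * 𝟙 r * 𝟙 (q ∧ s)
  𝟙-∧-interchange p q r s = begin
    𝟙 ((p ∧ q) ∧ (r ∧ s))             ≡⟨ trans (𝟙-∧ (p ∧ q) (r ∧ s)) (cong₂ _*_ (𝟙-∧ p q) (𝟙-∧ r s)) ⟩
    𝟙 p * 𝟙 q * (𝟙 r * 𝟙 s)           ≡⟨ regroup (𝟙 p) (𝟙 q) (𝟙 r) (𝟙 s) ⟩
    𝟙 p * 𝟙 r * (𝟙 q * 𝟙 s)           ≡⟨ cong (𝟙 p * 𝟙 r *_) (sym (𝟙-∧ q s)) ⟩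
    𝟙 p * 𝟙 r * 𝟙 (q ∧ s)             ∎
    where
    regroup : ∀ a b c d → a * b * (c * d) ≡ a * c * (b * d)
    regroup = solve-∀

  T-injective : ∀ {a b} → (T a → T b) → (T b → T a) → a ≡ b
  T-injective {true}  {true}  _   _   = refl
  T-injective {true}  {false} a⇒b _   = ⊥-elim (a⇒b _)
  T-injective {false} {true}  _   b⇒a = ⊥-elim (b⇒a _)
  T-injective {false} {false} _   _   = refl

  Σ< : ℕ → (ℕ → ℕ) → ℕ
  Σ< n f = ∑ (f ∘ toℕ {n})

  Σ<-cong : ∀ n {f g : ℕ → ℕ} → (∀ i → i < n → f i ≡ g i) → Σ< n f ≡ Σ< n g
  Σ<-cong n f≡g = sum-cong-≗ (λ i → f≡g (toℕ i) (toℕ<n i))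

  Σ<-cong′ : ∀ n {f g : ℕ → ℕ} → (∀ i → f i ≡ g i) → Σ< n f ≡ Σ< n g
  Σ<-cong′ n f≡g = Σ<-cong n (λ i _ → f≡g i)

  Σ<-distrib-+ : ∀ n (f g : ℕ → ℕ) → Σ< n (λ i → f i + g i) ≡ Σ< n f + Σ< n g
  Σ<-distrib-+ n f g = ∑-distrib-+ {n} (f ∘ toℕ) (g ∘ toℕ)

  *-distribˡ-Σ< : ∀ n c (f : ℕ → ℕ) → Σ< n (λ i → c * f i) ≡ c * Σ< n f
  *-distribˡ-Σ< n c f = sym (*-distribˡ-sum {n} c (f ∘ toℕ))

  Σ<-comm : ∀ n k (f : ℕ → ℕ → ℕ) → Σ< n (λ i → Σ< k (f i)) ≡ Σ< k (λ j → Σ< n (λ i → f i j))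
  Σ<-comm n k f = ∑-comm {n} {k} (λ i j → f (toℕ i) (toℕ j))

  Σ<-zero : ∀ n → Σ< n (λ _ → 0) ≡ 0
  Σ<-zero n = sum-replicate-zero n

  Σ<-init-last : ∀ n (f : ℕ → ℕ) → Σ< (suc n) f ≡ Σ< n f + f n
  Σ<-init-last zero    f = +-comm (f 0) 0
  Σ<-init-last (suc n) f = trans (cong (f 0 +_) (Σ<-init-last n (f ∘ suc))) (sym (+-assoc (f 0) _ _))

  Σ<-extend : ∀ {n N} (f : ℕ → ℕ) → n ≤ N → (∀ i → n ≤ i → f i ≡ 0) → Σ< N f ≡ Σ< n f
  Σ<-extend {zero}  {zero}  f _         _    = refl
  Σ<-extend {zero}  {suc N} f _         f≡0 =
    cong₂ _+_ (f≡0 0 z≤n) (Σ<-extend {N = N} (f ∘ suc) z≤n (λ i _ → f≡0 (suc i) z≤n))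
  Σ<-extend {suc n} {suc N} f (s≤s n≤N) f≡0 = cong (f 0 +_) (Σ<-extend (f ∘ suc) n≤N (λ i n≤i → f≡0 (suc i) (s≤s n≤i)))

  *-*-distribˡ-Σ< : ∀ n c b (f : ℕ → ℕ) → c * (b * Σ< n f) ≡ Σ< n (λ a → c * (b * f a))
  *-*-distribˡ-Σ< n c b f = sym (trans (*-distribˡ-Σ< n c (λ a → b * f a)) (cong (c *_) (*-distribˡ-Σ< n b f)))

  Σ<-support : ∀ n l (f : ℕ → ℕ) → (∀ i → n ≤ i → f i ≡ 0) → (∀ i → l ≤ i → f i ≡ 0) → Σ< n f ≡ Σ< l f
  Σ<-support n l f f≡0₁ f≡0₂ = begin
    Σ< n f        ≡⟨ sym (Σ<-extend f (m≤m+n n l) f≡0₁) ⟩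
    Σ< (n + l) f  ≡⟨ cong (λ N → Σ< N f) (+-comm n l) ⟩
    Σ< (l + n) f  ≡⟨ Σ<-extend f (m≤m+n l n) f≡0₂ ⟩
    Σ< l f        ∎

  Σ<-select : ∀ n i (f : ℕ → ℕ) → (n ≤ i → f i ≡ 0) → Σ< n (λ j → 𝟙 (i ≡ᵇ j) * f j) ≡ f i
  Σ<-select zero    i       f f≡0 = sym (f≡0 z≤n)
  Σ<-select (suc n) zero    f _   = trans (cong₂ _+_ (+-identityʳ (f 0)) (Σ<-zero n)) (+-identityʳ (f 0))
  Σ<-select (suc n) (suc i) f f≡0 = Σ<-select n i (f ∘ suc) (f≡0 ∘ s≤s)

  Σ<-truncate : ∀ {k b} (f : ℕ → ℕ) → k ≤ b → Σ< (suc b) (λ a → 𝟙 (a ≤ᵇ k) * f a) ≡ Σ< (suc k) f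
  Σ<-truncate {k} f k≤b = trans
    (Σ<-extend _ (s≤s k≤b) (λ a k<a → cong (_* f a) (𝟙-¬T (<⇒≱ k<a ∘ ≤ᵇ⇒≤ a k))))
    (Σ<-cong (suc k) (λ a a<1+k → trans (cong (_* f a) (𝟙-T (≤⇒≤ᵇ (≤-pred a<1+k)))) (*-identityˡ (f a))))

  ∑∈ : {A : Set} → List A → (A → ℕ) → ℕ
  ∑∈ xs f = sum (map f xs)

  ∑∈-cong : {A : Set} (xs : List A) {f g : A → ℕ} → (∀ x → f x ≡ g x) → ∑∈ xs f ≡ ∑∈ xs g
  ∑∈-cong xs f≡g = cong sum (map-cong f≡g xs)

  ∑∈-map : {A B : Set} (g : A → B) (xs : List A) (f : B → ℕ) → ∑∈ (map g xs) f ≡ ∑∈ xs (f ∘ g)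
  ∑∈-map g xs f = cong sum (sym (map-∘ xs))

  ∑∈-concatMap : {A B : Set} (F : A → List B) (xs : List A) (f : B → ℕ) →
    ∑∈ (concatMap F xs) f ≡ ∑∈ xs (λ x → ∑∈ (F x) f)
  ∑∈-concatMap F []       f = refl
  ∑∈-concatMap F (x ∷ xs) f = begin
    sum (map f (F x ++ concatMap F xs))     ≡⟨ cong sum (map-++ f (F x) (concatMap F xs)) ⟩
    sum (map f (F x) ++ map f (concatMap F xs)) ≡⟨ sum-++ (map f (F x)) _ ⟩
    ∑∈ (F x) f + ∑∈ (concatMap F xs) f      ≡⟨ cong (∑∈ (F x) f +_) (∑∈-concatMap F xs f) ⟩
    ∑∈ (F x) f + ∑∈ xs (λ y → ∑∈ (F y) f)   ∎

  *-distribˡ-∑∈ : {A : Set} (xs : List A) (c : ℕ) (f : A → ℕ) → ∑∈ xs (λ x → c * f x) ≡ c * ∑∈ xs f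
  *-distribˡ-∑∈ []       c f = sym (*-zeroʳ c)
  *-distribˡ-∑∈ (x ∷ xs) c f = trans (cong (c * f x +_) (*-distribˡ-∑∈ xs c f)) (sym (*-distribˡ-+ c (f x) _))

  ∑∈-∑-comm : {A : Set} {n : ℕ} (xs : List A) (f : A → Fin n → ℕ) →
    ∑∈ xs (λ x → ∑ (f x)) ≡ ∑ (λ j → ∑∈ xs (λ x → f x j))
  ∑∈-∑-comm {n = n} []       f = sym (sum-replicate-zero n)
  ∑∈-∑-comm         (x ∷ xs) f = trans (cong (∑ (f x) +_) (∑∈-∑-comm xs f)) (sym (∑-distrib-+ (f x) _))

  ∑∈-applyUpTo : (g : ℕ → ℕ) (n : ℕ) (f : ℕ → ℕ) → ∑∈ (applyUpTo g n) f ≡ Σ< n (f ∘ g)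
  ∑∈-applyUpTo g zero    f = refl
  ∑∈-applyUpTo g (suc n) f = cong (f (g 0) +_) (∑∈-applyUpTo (g ∘ suc) n f)

  ∑∈-tabulate : {A : Set} {n : ℕ} (g : Fin n → A) (f : A → ℕ) → ∑∈ (tabulate g) f ≡ ∑ (f ∘ g)
  ∑∈-tabulate {n = zero}  g f = refl
  ∑∈-tabulate {n = suc n} g f = cong (f (g Fin.zero) +_) (∑∈-tabulate (g ∘ Fin.suc) f)

  length-filterᵇ : {A : Set} (p : A → Bool) (xs : List A) → length (filterᵇ p xs) ≡ ∑∈ xs (𝟙 ∘ p)
  length-filterᵇ p []       = refl
  length-filterᵇ p (x ∷ xs) with p x
  ... | true  = cong suc (length-filterᵇ p xs)
  ... | false = length-filterᵇ p xs

  -- Binomial coefficients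

  nCk*[k!*[n∸k]!]≡n! : ∀ {n k} → k ≤ n → (n C k) * (k ! * (n ∸ k) !) ≡ n !
  nCk*[k!*[n∸k]!]≡n! {n} {k} k≤n = trans (cong (_* (k ! * (n ∸ k) !)) (nCk≡n!/k![n-k]! k≤n)) (m/n*n≡m (k![n∸k]!∣n! k≤n))
    where instance _ = k !* (n ∸ k) !≢0

  Σ<-Pascal : ∀ k (X : ℕ → ℕ) →
    Σ< (suc (suc k)) (λ a → (suc k C a) * X a) ≡
    Σ< (suc k) (λ a → (k C a) * X a) + Σ< (suc k) (λ a → (k C a) * X (suc a))
  Σ<-Pascal k X = begin
    1 * X 0 + Σ< (suc k) (λ a → (suc k C suc a) * X (suc a))
      ≡⟨ cong (1 * X 0 +_) (Σ<-cong′ (suc k) (λ a → cong (_* X (suc a)) (sym (nCk+nC[k+1]≡[n+1]C[k+1] k a)))) ⟩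
    1 * X 0 + Σ< (suc k) (λ a → ((k C a) + (k C suc a)) * X (suc a))
      ≡⟨ cong (1 * X 0 +_) (trans (Σ<-cong′ (suc k) (λ a → *-distribʳ-+ (X (suc a)) (k C a) (k C suc a)))
                                  (Σ<-distrib-+ (suc k) (λ a → (k C a) * X (suc a)) (λ a → (k C suc a) * X (suc a)))) ⟩
    1 * X 0 + (Σ< (suc k) (λ a → (k C a) * X (suc a)) + Σ< (suc k) (λ a → (k C suc a) * X (suc a)))
      ≡⟨ cong (λ z → 1 * X 0 + (Σ< (suc k) (λ a → (k C a) * X (suc a)) + z)) (Σ<-init-last k (λ a → (k C suc a) * X (suc a))) ⟩
    1 * X 0 + (A + (B + (k C suc k) * X (suc k)))
      ≡⟨ cong (λ z → 1 * X 0 + (A + (B + z * X (suc k)))) (k>n⇒nCk≡0 (n<1+n k)) ⟩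
    1 * X 0 + (A + (B + 0 * X (suc k)))
      ≡⟨ rearrange (1 * X 0) A B (X (suc k)) ⟩
    (1 * X 0 + B) + A ∎
    where
    A = Σ< (suc k) (λ a → (k C a) * X (suc a))
    B = Σ< k (λ a → (k C suc a) * X (suc a))
    rearrange : ∀ x a b y → x + (a + (b + 0 * y)) ≡ (x + b) + a
    rearrange = solve-∀

  ∸-comm : ∀ m n o → m ∸ n ∸ o ≡ m ∸ o ∸ n
  ∸-comm m n o = trans (∸-+-assoc m n o) (trans (cong (m ∸_) (+-comm n o)) (sym (∸-+-assoc m o n)))

  m<n+o∧n≤k≤m⇒m∸k<o : ∀ {m n k o} → n ≤ k → k ≤ m → m < n + o → m ∸ k < o
  m<n+o∧n≤k≤m⇒m∸k<o {m} {n} {k} {o} n≤k k≤m m<n+o = ≤-<-trans (∸-monoʳ-≤ m n≤k)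
    (+-cancelʳ-< n (m ∸ n) o (subst₂ _<_ (sym (m∸n+n≡m (≤-trans n≤k k≤m))) (+-comm n o) m<n+o))

  nCj*[n∸j]Ci*[j!*[i!*[n∸j∸i]!]]≡n! : ∀ n j i → i + j ≤ n →
    (n C j) * ((n ∸ j) C i) * (j ! * (i ! * (n ∸ j ∸ i) !)) ≡ n !
  nCj*[n∸j]Ci*[j!*[i!*[n∸j∸i]!]]≡n! n j i i+j≤n = begin
    (n C j) * ((n ∸ j) C i) * (j ! * (i ! * (n ∸ j ∸ i) !))
      ≡⟨ regroup (n C j) ((n ∸ j) C i) (j !) (i !) ((n ∸ j ∸ i) !) ⟩
    (n C j) * (j ! * (((n ∸ j) C i) * (i ! * (n ∸ j ∸ i) !)))
      ≡⟨ cong (λ z → (n C j) * (j ! * z)) (nCk*[k!*[n∸k]!]≡n! (m+n≤o⇒m≤o∸n i i+j≤n)) ⟩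
    (n C j) * (j ! * (n ∸ j) !)
      ≡⟨ nCk*[k!*[n∸k]!]≡n! (m+n≤o⇒n≤o i i+j≤n) ⟩
    n ! ∎
    where
    regroup : ∀ a b c d e → a * b * (c * (d * e)) ≡ a * (c * (b * (d * e)))
    regroup = solve-∀

  nCj*[n∸j]Ci≡0 : ∀ {n j i} → n < i + j → (n C j) * ((n ∸ j) C i) ≡ 0
  nCj*[n∸j]Ci≡0 {n} {j} {i} n<i+j with j ≤? n
  ... | yes j≤n = trans (cong ((n C j) *_) (k>n⇒nCk≡0 n∸j<i)) (*-zeroʳ (n C j))
    where
    n∸j<i : n ∸ j < i
    n∸j<i = m<n+o∧n≤k≤m⇒m∸k<o ≤-refl j≤n (subst (n <_) (+-comm i j) n<i+j)
  ... | no j≰n = cong (_* ((n ∸ j) C i)) (k>n⇒nCk≡0 (≰⇒> j≰n))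

  nCj*[n∸j]Ci≡nCi*[n∸i]Cj : ∀ n j i → (n C j) * ((n ∸ j) C i) ≡ (n C i) * ((n ∸ i) C j)
  nCj*[n∸j]Ci≡nCi*[n∸i]Cj n j i with i + j ≤? n
  ... | no i+j≰n = trans (nCj*[n∸j]Ci≡0 {n} {j} {i} (≰⇒> i+j≰n))
                          (sym (nCj*[n∸j]Ci≡0 {n} {i} {j} (subst (n <_) (+-comm i j) (≰⇒> i+j≰n))))
  ... | yes i+j≤n = *-cancelʳ-≡ ((n C j) * ((n ∸ j) C i)) ((n C i) * ((n ∸ i) C j)) (j ! * (i ! * (n ∸ j ∸ i) !))
    (trans (nCj*[n∸j]Ci*[j!*[i!*[n∸j∸i]!]]≡n! n j i i+j≤n) (sym (begin
    (n C i) * ((n ∸ i) C j) * (j ! * (i ! * (n ∸ j ∸ i) !))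
      ≡⟨ cong (λ z → (n C i) * ((n ∸ i) C j) * z)
              (trans (x*[y*z]≡y*[x*z] (j !) (i !) ((n ∸ j ∸ i) !)) (cong (λ z → i ! * (j ! * z !)) (∸-comm n j i))) ⟩
    (n C i) * ((n ∸ i) C j) * (i ! * (j ! * (n ∸ i ∸ j) !))
      ≡⟨ nCj*[n∸j]Ci*[j!*[i!*[n∸j∸i]!]]≡n! n i j (subst (_≤ n) (+-comm i j) i+j≤n) ⟩
    n ! ∎)))
    where
    instance _ = m*n≢0 (j !) (i ! * (n ∸ j ∸ i) !) {{j !≢0}} {{i !* (n ∸ j ∸ i) !≢0}}
    x*[y*z]≡y*[x*z] : ∀ x y z → x * (y * z) ≡ y * (x * z)
    x*[y*z]≡y*[x*z] = solve-∀

  [n∸k]*[nCk*k!]≡nC[1+k]*[1+k]! : ∀ n k → (n ∸ k) * ((n C k) * k !) ≡ (n C suc k) * suc k !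
  [n∸k]*[nCk*k!]≡nC[1+k]*[1+k]! n k with suc k ≤? n
  ... | no 1+k≰n = trans (cong (_* ((n C k) * k !)) (m≤n⇒m∸n≡0 (≤-pred (≰⇒> 1+k≰n))))
                         (sym (cong (_* suc k !) (k>n⇒nCk≡0 (≰⇒> 1+k≰n))))
  ... | yes k<n = *-cancelʳ-≡ _ _ ((n ∸ suc k) !) (begin
    (n ∸ k) * ((n C k) * k !) * (n ∸ suc k) !    ≡⟨ regroup (n ∸ k) (n C k) (k !) ((n ∸ suc k) !) ⟩
    (n C k) * (k ! * ((n ∸ k) * (n ∸ suc k) !))  ≡⟨ cong (λ z → (n C k) * (k ! * z)) ([n-k]*[n-k-1]!≡[n-k]! k<n) ⟩
    (n C k) * (k ! * (n ∸ k) !)                  ≡⟨ nCk*[k!*[n∸k]!]≡n! (<⇒≤ k<n) ⟩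
    n !                                          ≡⟨ sym (nCk*[k!*[n∸k]!]≡n! k<n) ⟩
    (n C suc k) * (suc k ! * (n ∸ suc k) !)      ≡⟨ sym (*-assoc (n C suc k) (suc k !) ((n ∸ suc k) !)) ⟩
    (n C suc k) * suc k ! * (n ∸ suc k) !        ∎)
    where
    instance _ = (n ∸ suc k) !≢0
    regroup : ∀ d c f r → d * (c * f) * r ≡ c * (f * (d * r))
    regroup = solve-∀

  -- Choosing blocks

  -- Sequences of a pairwise disjoint i-subsets of a w-set.
  orderedBlocks : ℕ → ℕ → ℕ → ℕ
  orderedBlocks w i zero    = 1
  orderedBlocks w i (suc a) = (w C i) * orderedBlocks (w ∸ i) i a

  w∸i*[1+a]≡w∸i∸i*a : ∀ w i a → w ∸ i * suc a ≡ w ∸ i ∸ i * a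
  w∸i*[1+a]≡w∸i∸i*a w i a = trans (cong (w ∸_) (*-suc i a)) (sym (∸-+-assoc w i (i * a)))

  orderedBlocks-vanish : ∀ w i a → w < i * a → orderedBlocks w i a ≡ 0
  orderedBlocks-vanish w i zero    w<i*0 = ⊥-elim (n≮0 (subst (w <_) (*-zeroʳ i) w<i*0))
  orderedBlocks-vanish w i (suc a) w<i*[1+a] with i ≤? w
  ... | no i≰w  = cong (_* orderedBlocks (w ∸ i) i a) (k>n⇒nCk≡0 (≰⇒> i≰w))
  ... | yes i≤w = trans (cong ((w C i) *_) (orderedBlocks-vanish (w ∸ i) i a w∸i<i*a)) (*-zeroʳ (w C i))
    where
    w∸i<i*a : w ∸ i < i * a
    w∸i<i*a = m<n+o∧n≤k≤m⇒m∸k<o ≤-refl i≤w (subst (w <_) (*-suc i a) w<i*[1+a])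

  orderedBlocks*[i!^a*[w∸i*a]!]≡w! : ∀ w i a → i * a ≤ w → orderedBlocks w i a * ((i !) ^ a * (w ∸ i * a) !) ≡ w !
  orderedBlocks*[i!^a*[w∸i*a]!]≡w! w i zero    _ rewrite *-zeroʳ i = trans (+-identityʳ _) (+-identityʳ _)
  orderedBlocks*[i!^a*[w∸i*a]!]≡w! w i (suc a) i*[1+a]≤w = begin
    (w C i) * orderedBlocks (w ∸ i) i a * (i ! * (i !) ^ a * (w ∸ i * suc a) !)
      ≡⟨ cong (λ z → (w C i) * orderedBlocks (w ∸ i) i a * (i ! * (i !) ^ a * z !)) (w∸i*[1+a]≡w∸i∸i*a w i a) ⟩
    (w C i) * orderedBlocks (w ∸ i) i a * (i ! * (i !) ^ a * (w ∸ i ∸ i * a) !)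
      ≡⟨ regroup ((w C i)) (orderedBlocks (w ∸ i) i a) (i !) ((i !) ^ a) ((w ∸ i ∸ i * a) !) ⟩
    (w C i) * (i ! * (orderedBlocks (w ∸ i) i a * ((i !) ^ a * (w ∸ i ∸ i * a) !)))
      ≡⟨ cong (λ z → (w C i) * (i ! * z)) (orderedBlocks*[i!^a*[w∸i*a]!]≡w! (w ∸ i) i a (m+n≤o⇒m≤o∸n (i * a) i*a+i≤w)) ⟩
    (w C i) * (i ! * (w ∸ i) !)
      ≡⟨ nCk*[k!*[n∸k]!]≡n! (m+n≤o⇒n≤o (i * a) i*a+i≤w) ⟩
    w ! ∎
    where
    i*a+i≤w : i * a + i ≤ w
    i*a+i≤w = subst (_≤ w) (trans (*-suc i a) (+-comm i (i * a))) i*[1+a]≤w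
    regroup : ∀ c o f p r → c * o * (f * p * r) ≡ c * (f * (o * (p * r)))
    regroup = solve-∀

  nCj*orderedBlocks≡orderedBlocks*nCj : ∀ w j i a →
    (w C j) * orderedBlocks (w ∸ j) i a ≡ orderedBlocks w i a * ((w ∸ i * a) C j)
  nCj*orderedBlocks≡orderedBlocks*nCj w j i zero rewrite *-zeroʳ i = trans (*-identityʳ _) (sym (+-identityʳ _))
  nCj*orderedBlocks≡orderedBlocks*nCj w j i (suc a) = begin
    (w C j) * (((w ∸ j) C i) * orderedBlocks (w ∸ j ∸ i) i a)
      ≡⟨ sym (*-assoc (w C j) _ _) ⟩
    (w C j) * ((w ∸ j) C i) * orderedBlocks (w ∸ j ∸ i) i a
      ≡⟨ cong₂ _*_ (nCj*[n∸j]Ci≡nCi*[n∸i]Cj w j i) (cong (λ z → orderedBlocks z i a) (∸-comm w j i)) ⟩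
    (w C i) * ((w ∸ i) C j) * orderedBlocks (w ∸ i ∸ j) i a
      ≡⟨ *-assoc (w C i) _ _ ⟩
    (w C i) * (((w ∸ i) C j) * orderedBlocks (w ∸ i ∸ j) i a)
      ≡⟨ cong ((w C i) *_) (nCj*orderedBlocks≡orderedBlocks*nCj (w ∸ i) j i a) ⟩
    (w C i) * (orderedBlocks (w ∸ i) i a * ((w ∸ i ∸ i * a) C j))
      ≡⟨ sym (*-assoc (w C i) _ _) ⟩
    (w C i) * orderedBlocks (w ∸ i) i a * ((w ∸ i ∸ i * a) C j)
      ≡⟨ cong (λ z → (w C i) * orderedBlocks (w ∸ i) i a * (z C j)) (sym (w∸i*[1+a]≡w∸i∸i*a w i a)) ⟩
    (w C i) * orderedBlocks (w ∸ i) i a * ((w ∸ i * suc a) C j) ∎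

  -- Partitions of a (1 + t) * a element set into a blocks of size 1 + t:
  -- the block of the last element is completed by t of the remaining elements.
  equipartitions : ℕ → ℕ → ℕ
  equipartitions t zero    = 1
  equipartitions t (suc a) = ((suc t * a + t) C t) * equipartitions t a

  equipartitions*[a!*[1+t]!^a]≡[[1+t]*a]! : ∀ t a → equipartitions t a * (a ! * (suc t !) ^ a) ≡ (suc t * a) !
  equipartitions*[a!*[1+t]!^a]≡[[1+t]*a]! t zero rewrite *-zeroʳ t = refl
  equipartitions*[a!*[1+t]!^a]≡[[1+t]*a]! t (suc a) = begin
    ((x + t) C t) * equipartitions t a * (suc a * a ! * (suc t * t ! * (suc t !) ^ a))
      ≡⟨ regroup ((x + t) C t) (equipartitions t a) (a !) (t !) ((suc t !) ^ a) t a ⟩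
    ((x + t) C t) * (t ! * (equipartitions t a * (a ! * (suc t !) ^ a))) * (suc a * suc t)
      ≡⟨ cong (λ z → ((x + t) C t) * (t ! * z) * (suc a * suc t)) (equipartitions*[a!*[1+t]!^a]≡[[1+t]*a]! t a) ⟩
    ((x + t) C t) * (t ! * x !) * (suc a * suc t)
      ≡⟨ cong (λ z → ((x + t) C t) * (t ! * z !) * (suc a * suc t)) (sym (m+n∸n≡m x t)) ⟩
    ((x + t) C t) * (t ! * (x + t ∸ t) !) * (suc a * suc t)
      ≡⟨ cong (_* (suc a * suc t)) (nCk*[k!*[n∸k]!]≡n! (m≤n+m t x)) ⟩
    (x + t) ! * (suc a * suc t)
      ≡⟨ F*[1+a]*[1+t]≡[1+x+t]*F ((x + t) !) t a ⟩
    suc (x + t) !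
      ≡⟨ cong _! (1+x+t≡[1+t]*[1+a] t a) ⟩
    (suc t * suc a) ! ∎
    where
    x = suc t * a
    regroup : ∀ c p A T Q t a → c * p * (suc a * A * (suc t * T * Q)) ≡ c * (T * (p * (A * Q))) * (suc a * suc t)
    regroup = solve-∀
    F*[1+a]*[1+t]≡[1+x+t]*F : ∀ F t a → F * (suc a * suc t) ≡ suc (suc t * a + t) * F
    F*[1+a]*[1+t]≡[1+x+t]*F = solve-∀
    1+x+t≡[1+t]*[1+a] : ∀ t a → suc (suc t * a + t) ≡ suc t * suc a
    1+x+t≡[1+t]*[1+a] = solve-∀

  -- Sets of a pairwise disjoint (1 + t)-subsets of a w-set.
  unorderedBlocks : ℕ → ℕ → ℕ → ℕ
  unorderedBlocks w t a = (w C (suc t * a)) * equipartitions t a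

  unorderedBlocks*[a!*[1+t]!^a*[w∸[1+t]*a]!]≡w! : ∀ w t a → suc t * a ≤ w →
    unorderedBlocks w t a * (a ! * (suc t !) ^ a * (w ∸ suc t * a) !) ≡ w !
  unorderedBlocks*[a!*[1+t]!^a*[w∸[1+t]*a]!]≡w! w t a [1+t]*a≤w = begin
    (w C (suc t * a)) * equipartitions t a * (a ! * (suc t !) ^ a * (w ∸ suc t * a) !)
      ≡⟨ regroup (w C (suc t * a)) (equipartitions t a) (a !) ((suc t !) ^ a) ((w ∸ suc t * a) !) ⟩
    (w C (suc t * a)) * (equipartitions t a * (a ! * (suc t !) ^ a) * (w ∸ suc t * a) !)
      ≡⟨ cong (λ z → (w C (suc t * a)) * (z * (w ∸ suc t * a) !)) (equipartitions*[a!*[1+t]!^a]≡[[1+t]*a]! t a) ⟩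
    (w C (suc t * a)) * ((suc t * a) ! * (w ∸ suc t * a) !)
      ≡⟨ nCk*[k!*[n∸k]!]≡n! [1+t]*a≤w ⟩
    w ! ∎
    where
    regroup : ∀ c p A Q r → c * p * (A * Q * r) ≡ c * (p * (A * Q) * r)
    regroup = solve-∀

  a!*unorderedBlocks≡orderedBlocks : ∀ w t a → a ! * unorderedBlocks w t a ≡ orderedBlocks w (suc t) a
  a!*unorderedBlocks≡orderedBlocks w t a with suc t * a ≤? w
  ... | yes [1+t]*a≤w = *-cancelʳ-≡ _ _ ((suc t !) ^ a * (w ∸ suc t * a) !) (begin
    a ! * unorderedBlocks w t a * ((suc t !) ^ a * (w ∸ suc t * a) !)
      ≡⟨ regroup (a !) (unorderedBlocks w t a) ((suc t !) ^ a) ((w ∸ suc t * a) !) ⟩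
    unorderedBlocks w t a * (a ! * (suc t !) ^ a * (w ∸ suc t * a) !)
      ≡⟨ unorderedBlocks*[a!*[1+t]!^a*[w∸[1+t]*a]!]≡w! w t a [1+t]*a≤w ⟩
    w !
      ≡⟨ sym (orderedBlocks*[i!^a*[w∸i*a]!]≡w! w (suc t) a [1+t]*a≤w) ⟩
    orderedBlocks w (suc t) a * ((suc t !) ^ a * (w ∸ suc t * a) !) ∎)
    where
    instance _ = m*n≢0 ((suc t !) ^ a) ((w ∸ suc t * a) !) {{m^n≢0 (suc t !) a {{suc t !≢0}}}} {{(w ∸ suc t * a) !≢0}}
    regroup : ∀ A B Q r → A * B * (Q * r) ≡ B * (A * Q * r)
    regroup = solve-∀
  ... | no [1+t]*a≰w = begin
    a ! * ((w C (suc t * a)) * equipartitions t a)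
      ≡⟨ cong (λ z → a ! * (z * equipartitions t a)) (k>n⇒nCk≡0 (≰⇒> [1+t]*a≰w)) ⟩
    a ! * 0
      ≡⟨ *-zeroʳ (a !) ⟩
    0
      ≡⟨ sym (orderedBlocks-vanish w (suc t) a (≰⇒> [1+t]*a≰w)) ⟩
    orderedBlocks w (suc t) a ∎

  Σ<-nCj*orderedBlocks : ∀ w i a (f : ℕ → ℕ → ℕ) →
    Σ< (suc w) (λ j → (w C j) * orderedBlocks (w ∸ j) i a * f j (w ∸ j ∸ i * a)) ≡
    orderedBlocks w i a * Σ< (suc (w ∸ i * a)) (λ j → ((w ∸ i * a) C j) * f j (w ∸ i * a ∸ j))
  Σ<-nCj*orderedBlocks w i a f = begin
    Σ< (suc w) (λ j → (w C j) * orderedBlocks (w ∸ j) i a * f j (w ∸ j ∸ i * a))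
      ≡⟨ Σ<-cong′ (suc w) (λ j → cong₂ (λ y z → y * f j z)
           (nCj*orderedBlocks≡orderedBlocks*nCj w j i a) (∸-comm w j (i * a))) ⟩
    Σ< (suc w) (λ j → orderedBlocks w i a * (r C j) * f j (r ∸ j))
      ≡⟨ Σ<-cong′ (suc w) (λ j → *-assoc (orderedBlocks w i a) (r C j) (f j (r ∸ j))) ⟩
    Σ< (suc w) (λ j → orderedBlocks w i a * ((r C j) * f j (r ∸ j)))
      ≡⟨ *-distribˡ-Σ< (suc w) (orderedBlocks w i a) (λ j → (r C j) * f j (r ∸ j)) ⟩
    orderedBlocks w i a * Σ< (suc w) (λ j → (r C j) * f j (r ∸ j))
      ≡⟨ cong (orderedBlocks w i a *_)
              (Σ<-extend _ (s≤s (m∸n≤m w (i * a))) (λ j r<j → cong (_* f j (r ∸ j)) (k>n⇒nCk≡0 r<j))) ⟩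
    orderedBlocks w i a * Σ< (suc r) (λ j → (r C j) * f j (r ∸ j)) ∎
    where r = w ∸ i * a

  -- Types of set partitions

  weightFrom : ℕ → List ℕ → ℕ
  weightFrom i []      = 0
  weightFrom i (a ∷ α) = i * a + weightFrom (suc i) α

  foldr-indexedFrom≡weightFrom : {f : ℕ × ℕ → ℕ → ℕ} → (∀ i a r → f (i , a) r ≡ i * a + r) →
    ∀ i α → foldr f 0 (indexedFrom i α) ≡ weightFrom i α
  foldr-indexedFrom≡weightFrom f≡ i []      = refl
  foldr-indexedFrom≡weightFrom f≡ i (a ∷ α) = trans (f≡ i a _) (cong (i * a +_) (foldr-indexedFrom≡weightFrom f≡ (suc i) α))

  weightα≡weightFrom1 : ∀ α → weightα α ≡ weightFrom 1 α
  weightα≡weightFrom1 = foldr-indexedFrom≡weightFrom (λ _ _ _ → refl) 1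

  -- Set partitions of a w-set with α_j blocks of size t + 1 + j.
  partitionsOfType : ℕ → ℕ → List ℕ → ℕ
  partitionsOfType t w []      = 1
  partitionsOfType t w (a ∷ α) = unorderedBlocks w t a * partitionsOfType (suc t) (w ∸ suc t * a) α

  partitionsOfType*denomFrom≡w! : ∀ t w α → weightFrom (suc t) α ≡ w →
    partitionsOfType t w α * denomFrom (suc t) α ≡ w !
  partitionsOfType*denomFrom≡w! t w []      refl = refl
  partitionsOfType*denomFrom≡w! t w (a ∷ α) weight≡w = begin
    unorderedBlocks w t a * partitionsOfType (suc t) w′ α * (a ! * (suc t !) ^ a * denomFrom (suc (suc t)) α)
      ≡⟨ regroup (unorderedBlocks w t a) (partitionsOfType (suc t) w′ α) (a ! * (suc t !) ^ a) (denomFrom (suc (suc t)) α) ⟩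
    unorderedBlocks w t a * (a ! * (suc t !) ^ a * (partitionsOfType (suc t) w′ α * denomFrom (suc (suc t)) α))
      ≡⟨ cong (λ z → unorderedBlocks w t a * (a ! * (suc t !) ^ a * z))
              (partitionsOfType*denomFrom≡w! (suc t) w′ α weight′≡w′) ⟩
    unorderedBlocks w t a * (a ! * (suc t !) ^ a * w′ !)
      ≡⟨ unorderedBlocks*[a!*[1+t]!^a*[w∸[1+t]*a]!]≡w! w t a (subst (suc t * a ≤_) weight≡w (m≤m+n (suc t * a) _)) ⟩
    w ! ∎
    where
    w′ = w ∸ suc t * a
    weight′≡w′ : weightFrom (suc (suc t)) α ≡ w′
    weight′≡w′ = sym (trans (cong (_∸ suc t * a) (sym weight≡w)) (m+n∸m≡n (suc t * a) _))
    regroup : ∀ b q f d → b * q * (f * d) ≡ b * (f * (q * d))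
    regroup = solve-∀

  coeffα≡partitionsOfType : ∀ n α → weightFrom 1 α ≡ n → coeffα n α ≡ partitionsOfType 0 n α
  coeffα≡partitionsOfType n α weight≡n = begin
    n ! / denomFrom 1 α
      ≡⟨ cong (_/ denomFrom 1 α) (sym (partitionsOfType*denomFrom≡w! 0 n α weight≡n)) ⟩
    partitionsOfType 0 n α * denomFrom 1 α / denomFrom 1 α
      ≡⟨ m*n/n≡m (partitionsOfType 0 n α) (denomFrom 1 α) ⟩
    partitionsOfType 0 n α ∎
    where instance _ = denomFrom-nonZero 1 α

  ∑∈-boundedSeqs : ∀ L b (f : List ℕ → ℕ) →
    ∑∈ (boundedSeqs (suc L) b) f ≡ Σ< (suc b) (λ a → ∑∈ (boundedSeqs L b) (λ α → f (a ∷ α)))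
  ∑∈-boundedSeqs L b f = begin
    ∑∈ (boundedSeqs (suc L) b) f
      ≡⟨ ∑∈-concatMap (λ α → map (_∷ α) (upTo (suc b))) (boundedSeqs L b) f ⟩
    ∑∈ (boundedSeqs L b) (λ α → ∑∈ (map (_∷ α) (upTo (suc b))) f)
      ≡⟨ ∑∈-cong (boundedSeqs L b) (λ α → trans (∑∈-map (_∷ α) (upTo (suc b)) f)
                                               (∑∈-applyUpTo (λ a → a) (suc b) (λ a → f (a ∷ α)))) ⟩
    ∑∈ (boundedSeqs L b) (λ α → Σ< (suc b) (λ a → f (a ∷ α)))
      ≡⟨ ∑∈-∑-comm {n = suc b} (boundedSeqs L b) (λ α a → f (toℕ a ∷ α)) ⟩
    Σ< (suc b) (λ a → ∑∈ (boundedSeqs L b) (λ α → f (a ∷ α))) ∎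

  -- Set compositions and Bell polynomials

  module _ (x : ℕ → ℕ) where

    blockWeight : ℕ → ℕ → ℕ
    blockWeight i j = 𝟙 (i ≤ᵇ j) * x j

    -- Weighted count of the ordered partitions of a w-set into k blocks of sizes ≥ i,
    -- a block of size j having weight x j.
    compositions : ℕ → ℕ → ℕ → ℕ
    compositions i zero    w = 𝟙 (w ≡ᵇ 0)
    compositions i (suc k) w = Σ< (suc w) (λ j → (w C j) * (blockWeight i j * compositions i k (w ∸ j)))

    blockWeight-split : ∀ i j → blockWeight i j ≡ 𝟙 (i ≡ᵇ j) * x i + blockWeight (suc i) j
    blockWeight-split i j = begin
      𝟙 (i ≤ᵇ j) * x j
        ≡⟨ cong (_* x j) (𝟙[i≤ᵇj]≡𝟙[i≡ᵇj]+𝟙[1+i≤ᵇj] i j) ⟩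
      (𝟙 (i ≡ᵇ j) + 𝟙 (suc i ≤ᵇ j)) * x j
        ≡⟨ *-distribʳ-+ (x j) (𝟙 (i ≡ᵇ j)) _ ⟩
      𝟙 (i ≡ᵇ j) * x j + blockWeight (suc i) j
        ≡⟨ cong (_+ blockWeight (suc i) j) (𝟙[i≡ᵇj]*fj≡𝟙[i≡ᵇj]*fi i j x) ⟩
      𝟙 (i ≡ᵇ j) * x i + blockWeight (suc i) j ∎

    compositions-vanish : ∀ i k w → w < i * k → compositions i k w ≡ 0
    compositions-vanish i zero    w w<i*0 = ⊥-elim (n≮0 (subst (w <_) (*-zeroʳ i) w<i*0))
    compositions-vanish i (suc k) w w<i*[1+k] =
      trans (Σ<-cong (suc w) (λ j j<1+w → term-vanishes j (≤-pred j<1+w))) (Σ<-zero (suc w))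
      where
      term-vanishes : ∀ j → j ≤ w → (w C j) * (blockWeight i j * compositions i k (w ∸ j)) ≡ 0
      term-vanishes j j≤w with i ≤? j
      ... | no i≰j  = trans (cong (λ z → (w C j) * (z * x j * compositions i k (w ∸ j))) (𝟙-¬T (i≰j ∘ ≤ᵇ⇒≤ i j)))
                            (*-zeroʳ (w C j))
      ... | yes i≤j = trans (cong (λ e → (w C j) * (blockWeight i j * e)) (compositions-vanish i k (w ∸ j) w∸j<i*k))
                            (trans (cong ((w C j) *_) (*-zeroʳ (blockWeight i j))) (*-zeroʳ (w C j)))
        where
        w∸j<i*k : w ∸ j < i * k
        w∸j<i*k = m<n+o∧n≤k≤m⇒m∸k<o i≤j j≤w (subst (w <_) (*-suc i k) w<i*[1+k])

    -- Compositions with exactly a blocks of size i, once the positions of these blocks are fixed.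
    byMinimalBlocks : ℕ → ℕ → ℕ → ℕ → ℕ
    byMinimalBlocks i k w a = orderedBlocks w i a * (x i ^ a * compositions (suc i) (k ∸ a) (w ∸ i * a))

    MinimalBlocksExpansion : ℕ → ℕ → Set
    MinimalBlocksExpansion i k = ∀ w → compositions i k w ≡ Σ< (suc k) (λ a → (k C a) * byMinimalBlocks i k w a)

    first-block-minimal : ∀ {i k} → MinimalBlocksExpansion i k → ∀ w →
      Σ< (suc w) (λ j → (w C j) * (𝟙 (i ≡ᵇ j) * x i * compositions i k (w ∸ j))) ≡
      Σ< (suc k) (λ a → (k C a) * byMinimalBlocks i (suc k) w (suc a))
    first-block-minimal {i} {k} expansion w = begin
      Σ< (suc w) (λ j → (w C j) * (𝟙 (i ≡ᵇ j) * x i * compositions i k (w ∸ j)))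
        ≡⟨ Σ<-cong′ (suc w) (λ j → regroup (w C j) (𝟙 (i ≡ᵇ j)) (x i) (compositions i k (w ∸ j))) ⟩
      Σ< (suc w) (λ j → 𝟙 (i ≡ᵇ j) * ((w C j) * x i * compositions i k (w ∸ j)))
        ≡⟨ Σ<-select (suc w) i (λ j → (w C j) * x i * compositions i k (w ∸ j))
             (λ w<i → cong (λ c → c * x i * compositions i k (w ∸ i)) (k>n⇒nCk≡0 w<i)) ⟩
      (w C i) * x i * compositions i k (w ∸ i)
        ≡⟨ cong ((w C i) * x i *_) (expansion (w ∸ i)) ⟩
      (w C i) * x i * Σ< (suc k) (λ a → (k C a) * byMinimalBlocks i k (w ∸ i) a)
        ≡⟨ sym (*-distribˡ-Σ< (suc k) ((w C i) * x i) (λ a → (k C a) * byMinimalBlocks i k (w ∸ i) a)) ⟩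
      Σ< (suc k) (λ a → (w C i) * x i * ((k C a) * byMinimalBlocks i k (w ∸ i) a))
        ≡⟨ Σ<-cong′ (suc k) one-more ⟩
      Σ< (suc k) (λ a → (k C a) * byMinimalBlocks i (suc k) w (suc a)) ∎
      where
      regroup : ∀ c d t e → c * (d * t * e) ≡ d * (c * t * e)
      regroup = solve-∀
      regroup′ : ∀ c t ck o ta e → c * t * (ck * (o * (ta * e))) ≡ ck * (c * o * (t * ta * e))
      regroup′ = solve-∀
      one-more : ∀ a → (w C i) * x i * ((k C a) * byMinimalBlocks i k (w ∸ i) a) ≡ (k C a) * byMinimalBlocks i (suc k) w (suc a)
      one-more a = trans
        (regroup′ (w C i) (x i) (k C a) (orderedBlocks (w ∸ i) i a) (x i ^ a) (compositions (suc i) (k ∸ a) (w ∸ i ∸ i * a)))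
        (cong (λ r → (k C a) * ((w C i) * orderedBlocks (w ∸ i) i a * (x i * x i ^ a * compositions (suc i) (k ∸ a) r)))
              (sym (w∸i*[1+a]≡w∸i∸i*a w i a)))

    first-block-larger : ∀ {i k} → MinimalBlocksExpansion i k → ∀ w →
      Σ< (suc w) (λ j → (w C j) * (blockWeight (suc i) j * compositions i k (w ∸ j))) ≡
      Σ< (suc k) (λ a → (k C a) * byMinimalBlocks i (suc k) w a)
    first-block-larger {i} {k} expansion w = begin
      Σ< (suc w) (λ j → (w C j) * (blockWeight (suc i) j * compositions i k (w ∸ j)))
        ≡⟨ Σ<-cong′ (suc w) (λ j → cong (λ e → (w C j) * (blockWeight (suc i) j * e)) (expansion (w ∸ j))) ⟩
      Σ< (suc w) (λ j → (w C j) * (blockWeight (suc i) j * Σ< (suc k) (λ a → (k C a) * byMinimalBlocks i k (w ∸ j) a)))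
        ≡⟨ Σ<-cong′ (suc w) (λ j → *-*-distribˡ-Σ< (suc k) (w C j) (blockWeight (suc i) j)
                                                    (λ a → (k C a) * byMinimalBlocks i k (w ∸ j) a)) ⟩
      Σ< (suc w) (λ j → Σ< (suc k) (λ a → (w C j) * (blockWeight (suc i) j * ((k C a) * byMinimalBlocks i k (w ∸ j) a))))
        ≡⟨ Σ<-cong′ (suc w) (λ j → Σ<-cong′ (suc k) (λ a → regroup (w C j) (blockWeight (suc i) j) (k C a)
             (orderedBlocks (w ∸ j) i a) (x i ^ a) (compositions (suc i) (k ∸ a) (w ∸ j ∸ i * a)))) ⟩
      Σ< (suc w) (λ j → Σ< (suc k) (λ a → (k C a) * x i ^ a * inner a j))
        ≡⟨ Σ<-comm (suc w) (suc k) (λ j a → (k C a) * x i ^ a * inner a j) ⟩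
      Σ< (suc k) (λ a → Σ< (suc w) (λ j → (k C a) * x i ^ a * inner a j))
        ≡⟨ Σ<-cong (suc k) (λ a a<1+k → trans (*-distribˡ-Σ< (suc w) ((k C a) * x i ^ a) (inner a))
             (cong ((k C a) * x i ^ a *_) (Σ-inner a (≤-pred a<1+k)))) ⟩
      Σ< (suc k) (λ a → (k C a) * x i ^ a * (orderedBlocks w i a * compositions (suc i) (suc k ∸ a) (w ∸ i * a)))
        ≡⟨ Σ<-cong′ (suc k) (λ a → regroup′ (k C a) (x i ^ a) (orderedBlocks w i a)
                                            (compositions (suc i) (suc k ∸ a) (w ∸ i * a))) ⟩
      Σ< (suc k) (λ a → (k C a) * byMinimalBlocks i (suc k) w a) ∎
      where
      inner : ℕ → ℕ → ℕ
      inner a j = (w C j) * orderedBlocks (w ∸ j) i a * (blockWeight (suc i) j * compositions (suc i) (k ∸ a) (w ∸ j ∸ i * a))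
      Σ-inner : ∀ a → a ≤ k → Σ< (suc w) (inner a) ≡ orderedBlocks w i a * compositions (suc i) (suc k ∸ a) (w ∸ i * a)
      Σ-inner a a≤k = trans (Σ<-nCj*orderedBlocks w i a (λ j r → blockWeight (suc i) j * compositions (suc i) (k ∸ a) r))
                            (cong (λ k′ → orderedBlocks w i a * compositions (suc i) k′ (w ∸ i * a)) (sym (+-∸-assoc 1 a≤k)))
      regroup : ∀ c b ck o t e → c * (b * (ck * (o * (t * e)))) ≡ ck * t * (c * o * (b * e))
      regroup = solve-∀
      regroup′ : ∀ c t o e → c * t * (o * e) ≡ c * (o * (t * e))
      regroup′ = solve-∀

    -- Induction on k: the first block has size i or larger, and Pascal's rule merges the two cases.
    compositions-by-minimal-blocks : ∀ i k → MinimalBlocksExpansion i k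
    compositions-by-minimal-blocks i zero w rewrite *-zeroʳ i = sym (unit (𝟙 (w ≡ᵇ 0)))
      where
      unit : ∀ e → 1 * (1 * (1 * e)) + 0 ≡ e
      unit = solve-∀
    compositions-by-minimal-blocks i (suc k) w = begin
      compositions i (suc k) w
        ≡⟨ Σ<-cong′ (suc w) split ⟩
      Σ< (suc w) (λ j → minimal j + larger j)
        ≡⟨ Σ<-distrib-+ (suc w) minimal larger ⟩
      Σ< (suc w) minimal + Σ< (suc w) larger
        ≡⟨ cong₂ _+_ (first-block-minimal {i} {k} (compositions-by-minimal-blocks i k) w)
                     (first-block-larger {i} {k} (compositions-by-minimal-blocks i k) w) ⟩
      Σ< (suc k) (λ a → (k C a) * X (suc a)) + Σ< (suc k) (λ a → (k C a) * X a)
        ≡⟨ +-comm (Σ< (suc k) (λ a → (k C a) * X (suc a))) (Σ< (suc k) (λ a → (k C a) * X a)) ⟩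
      Σ< (suc k) (λ a → (k C a) * X a) + Σ< (suc k) (λ a → (k C a) * X (suc a))
        ≡⟨ sym (Σ<-Pascal k X) ⟩
      Σ< (suc (suc k)) (λ a → (suc k C a) * X a) ∎
      where
      X : ℕ → ℕ
      X = byMinimalBlocks i (suc k) w
      minimal larger : ℕ → ℕ
      minimal j = (w C j) * (𝟙 (i ≡ᵇ j) * x i * compositions i k (w ∸ j))
      larger j = (w C j) * (blockWeight (suc i) j * compositions i k (w ∸ j))
      split : ∀ j → (w C j) * (blockWeight i j * compositions i k (w ∸ j)) ≡ minimal j + larger j
      split j = trans (cong (λ b → (w C j) * (b * compositions i k (w ∸ j))) (blockWeight-split i j))
                      (distrib (w C j) (𝟙 (i ≡ᵇ j) * x i) (blockWeight (suc i) j) (compositions i k (w ∸ j)))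
        where
        distrib : ∀ c p q e → c * ((p + q) * e) ≡ c * (p * e) + c * (q * e)
        distrib = solve-∀


    monomial : ℕ → List ℕ → ℕ
    monomial i []      = 1
    monomial i (a ∷ α) = x i ^ a * monomial (suc i) α

    -- bell w k restricted to the types in boundedSeqs L b, with α_j counting blocks of size t + 1 + j.
    typeSum : ℕ → ℕ → ℕ → ℕ → ℕ → ℕ
    typeSum t L b w k = ∑∈ (boundedSeqs L b) (λ α →
      𝟙 ((sumα α ≡ᵇ k) ∧ (weightFrom (suc t) α ≡ᵇ w)) * (partitionsOfType t w α * monomial (suc t) α))

    typeSum-cons : ∀ t L b w k → typeSum t (suc L) b w k ≡
      Σ< (suc b) (λ a → 𝟙 (a ≤ᵇ k) * 𝟙 (suc t * a ≤ᵇ w) * (unorderedBlocks w t a * x (suc t) ^ a) *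
                        typeSum (suc t) L b (w ∸ suc t * a) (k ∸ a))
    typeSum-cons t L b w k = trans (∑∈-boundedSeqs L b whole) (Σ<-cong′ (suc b) (λ a →
      trans (∑∈-cong (boundedSeqs L b) (summand a)) (*-distribˡ-∑∈ (boundedSeqs L b) (u a) (term a))))
      where
      w′ : ℕ → ℕ
      w′ a = w ∸ suc t * a
      whole : List ℕ → ℕ
      whole α = 𝟙 ((sumα α ≡ᵇ k) ∧ (weightFrom (suc t) α ≡ᵇ w)) * (partitionsOfType t w α * monomial (suc t) α)
      u : ℕ → ℕ
      u a = 𝟙 (a ≤ᵇ k) * 𝟙 (suc t * a ≤ᵇ w) * (unorderedBlocks w t a * x (suc t) ^ a)
      term : ℕ → List ℕ → ℕ
      term a α = 𝟙 ((sumα α ≡ᵇ k ∸ a) ∧ (weightFrom (suc (suc t)) α ≡ᵇ w′ a)) *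
                 (partitionsOfType (suc t) (w′ a) α * monomial (suc (suc t)) α)
      summand : ∀ a α → whole (a ∷ α) ≡ u a * term a α
      summand a α = begin
        𝟙 ((a + sumα α ≡ᵇ k) ∧ (suc t * a + weightFrom (suc (suc t)) α ≡ᵇ w)) * rest
          ≡⟨ cong₂ (λ p q → 𝟙 (p ∧ q) * rest)
                   (≡ᵇ-+-split a (sumα α) k) (≡ᵇ-+-split (suc t * a) (weightFrom (suc (suc t)) α) w) ⟩
        𝟙 (((a ≤ᵇ k) ∧ (sumα α ≡ᵇ k ∸ a)) ∧ ((suc t * a ≤ᵇ w) ∧ (weightFrom (suc (suc t)) α ≡ᵇ w′ a))) * rest
          ≡⟨ cong (_* rest)
                  (𝟙-∧-interchange (a ≤ᵇ k) (sumα α ≡ᵇ k ∸ a) (suc t * a ≤ᵇ w) (weightFrom (suc (suc t)) α ≡ᵇ w′ a)) ⟩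
        𝟙 (a ≤ᵇ k) * 𝟙 (suc t * a ≤ᵇ w) * 𝟙 ((sumα α ≡ᵇ k ∸ a) ∧ (weightFrom (suc (suc t)) α ≡ᵇ w′ a)) * rest
          ≡⟨ regroup (𝟙 (a ≤ᵇ k)) (𝟙 (suc t * a ≤ᵇ w)) _ (unorderedBlocks w t a) (partitionsOfType (suc t) (w′ a) α)
                     (x (suc t) ^ a) (monomial (suc (suc t)) α) ⟩
        u a * term a α ∎
        where
        rest = unorderedBlocks w t a * partitionsOfType (suc t) (w′ a) α * (x (suc t) ^ a * monomial (suc (suc t)) α)
        regroup : ∀ i j l u q p m → i * j * l * (u * q * (p * m)) ≡ i * j * (u * p) * (l * (q * m))
        regroup = solve-∀

    w∸[1+t]*a<[1+t]+L+[k∸a] : ∀ {t L k w a} → a ≤ k → suc t * a ≤ w → w < t + suc L + k →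
      w ∸ suc t * a < suc t + L + (k ∸ a)
    w∸[1+t]*a<[1+t]+L+[k∸a] {t} {L} {k} {w} {a} a≤k [1+t]*a≤w w<t+[1+L]+k =
      ≤-<-trans (∸-monoʳ-≤ w a≤[1+t]*a)
        (subst (w ∸ a <_) (trans (cong (λ s → s + k ∸ a) (+-suc t L)) (+-∸-assoc (suc t + L) a≤k))
          (∸-monoˡ-< w<t+[1+L]+k (≤-trans a≤[1+t]*a [1+t]*a≤w)))
      where
      a≤[1+t]*a : a ≤ suc t * a
      a≤[1+t]*a = m≤n*m a (suc t)

    t+[1+k]≤[1+t]*[1+k] : ∀ t k → t + suc k ≤ suc t * suc k
    t+[1+k]≤[1+t]*[1+k] t k = subst (t + suc k ≤_) (expand t k) (m≤m+n (t + suc k) (t * k))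
      where
      expand : ∀ t k → t + suc k + t * k ≡ suc t * suc k
      expand = solve-∀

    -- The bound w < t + L + k rules out blocks of size t + 1 + L or more, so types of length L suffice.
    TypeSumIdentity : ℕ → ℕ → ℕ → Set
    TypeSumIdentity L t b = ∀ w k → k ≤ b → w < t + L + k → k ! * typeSum t L b w k ≡ compositions (suc t) k w

    k!*typeSum-cons-term : ∀ {L t b w k} → TypeSumIdentity L (suc t) b → k ≤ b → w < t + suc L + k → ∀ a →
      k ! * (𝟙 (a ≤ᵇ k) * 𝟙 (suc t * a ≤ᵇ w) * (unorderedBlocks w t a * x (suc t) ^ a) *
             typeSum (suc t) L b (w ∸ suc t * a) (k ∸ a)) ≡
      𝟙 (a ≤ᵇ k) * ((k C a) * byMinimalBlocks (suc t) k w a)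
    k!*typeSum-cons-term {L} {t} {b} {w} {k} identity k≤b w<t+[1+L]+k a with a ≤? k
    ... | no a≰k rewrite 𝟙-¬T (a≰k ∘ ≤ᵇ⇒≤ a k) = *-zeroʳ (k !)
    ... | yes a≤k with suc t * a ≤? w
    ...   | no [1+t]*a≰w rewrite 𝟙-T (≤⇒≤ᵇ a≤k) | 𝟙-¬T ([1+t]*a≰w ∘ ≤ᵇ⇒≤ _ w)
                               | orderedBlocks-vanish w (suc t) a (≰⇒> [1+t]*a≰w) =
      trans (*-zeroʳ (k !)) (sym (trans (+-identityʳ _) (*-zeroʳ (k C a))))
    ...   | yes [1+t]*a≤w rewrite 𝟙-T (≤⇒≤ᵇ a≤k) | 𝟙-T (≤⇒≤ᵇ [1+t]*a≤w) = begin
      k ! * (1 * (unorderedBlocks w t a * x (suc t) ^ a) * rest)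
        ≡⟨ cong (_* (1 * (unorderedBlocks w t a * x (suc t) ^ a) * rest)) (sym (nCk*[k!*[n∸k]!]≡n! a≤k)) ⟩
      (k C a) * (a ! * (k ∸ a) !) * (1 * (unorderedBlocks w t a * x (suc t) ^ a) * rest)
        ≡⟨ regroup (k C a) (a !) ((k ∸ a) !) (unorderedBlocks w t a) (x (suc t) ^ a) rest ⟩
      (k C a) * (a ! * unorderedBlocks w t a * (x (suc t) ^ a * ((k ∸ a) ! * rest))) + 0
        ≡⟨ cong₂ (λ p q → (k C a) * (p * (x (suc t) ^ a * q)) + 0)
                 (a!*unorderedBlocks≡orderedBlocks w t a)
                 (identity (w ∸ suc t * a) (k ∸ a) (≤-trans (m∸n≤m k a) k≤b)
                   (w∸[1+t]*a<[1+t]+L+[k∸a] a≤k [1+t]*a≤w w<t+[1+L]+k)) ⟩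
      (k C a) * byMinimalBlocks (suc t) k w a + 0 ∎
      where
      rest = typeSum (suc t) L b (w ∸ suc t * a) (k ∸ a)
      regroup : ∀ c f g b p r → c * (f * g) * (1 * (b * p) * r) ≡ c * (f * b * (p * (g * r))) + 0
      regroup = solve-∀

    k!*typeSum≡compositions : ∀ L t b → TypeSumIdentity L t b
    k!*typeSum≡compositions zero t b zero    zero    _ _ = refl
    k!*typeSum≡compositions zero t b (suc w) zero    _ _ = refl
    k!*typeSum≡compositions zero t b w       (suc k) _ w<t+0+[1+k] =
      trans (*-zeroʳ (suc k !)) (sym (compositions-vanish (suc t) (suc k) w
        (<-≤-trans (subst (λ s → w < s + suc k) (+-identityʳ t) w<t+0+[1+k]) (t+[1+k]≤[1+t]*[1+k] t k))))
    k!*typeSum≡compositions (suc L) t b w k k≤b w<t+[1+L]+k = begin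
      k ! * typeSum t (suc L) b w k
        ≡⟨ cong (k ! *_) (typeSum-cons t L b w k) ⟩
      k ! * Σ< (suc b) term
        ≡⟨ sym (*-distribˡ-Σ< (suc b) (k !) term) ⟩
      Σ< (suc b) (λ a → k ! * term a)
        ≡⟨ Σ<-cong′ (suc b) (k!*typeSum-cons-term {L} {t} (k!*typeSum≡compositions L (suc t) b) k≤b w<t+[1+L]+k) ⟩
      Σ< (suc b) (λ a → 𝟙 (a ≤ᵇ k) * ((k C a) * byMinimalBlocks (suc t) k w a))
        ≡⟨ Σ<-truncate (λ a → (k C a) * byMinimalBlocks (suc t) k w a) k≤b ⟩
      Σ< (suc k) (λ a → (k C a) * byMinimalBlocks (suc t) k w a)
        ≡⟨ sym (compositions-by-minimal-blocks (suc t) k w) ⟩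
      compositions (suc t) k w ∎
      where
      term : ℕ → ℕ
      term a = 𝟙 (a ≤ᵇ k) * 𝟙 (suc t * a ≤ᵇ w) * (unorderedBlocks w t a * x (suc t) ^ a) *
               typeSum (suc t) L b (w ∸ suc t * a) (k ∸ a)

    bellℕ : ℕ → ℕ → ℕ
    bellℕ n k = ∑∈ (boundedSeqs (n ∸ k + 1) k) (λ α →
      𝟙 ((sumα α ≡ᵇ k) ∧ (weightα α ≡ᵇ n)) * (coeffα n α * monomial 1 α))

    bellℕ≡typeSum : ∀ n k → bellℕ n k ≡ typeSum 0 (n ∸ k + 1) k n k
    bellℕ≡typeSum n k = ∑∈-cong (boundedSeqs (n ∸ k + 1) k) summand
      where
      summand : ∀ α → 𝟙 ((sumα α ≡ᵇ k) ∧ (weightα α ≡ᵇ n)) * (coeffα n α * monomial 1 α) ≡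
                      𝟙 ((sumα α ≡ᵇ k) ∧ (weightFrom 1 α ≡ᵇ n)) * (partitionsOfType 0 n α * monomial 1 α)
      summand α rewrite weightα≡weightFrom1 α with sumα α ≡ᵇ k | weightFrom 1 α ≡ᵇ n in weight≡ᵇn
      ... | false | _     = refl
      ... | true  | false = refl
      ... | true  | true  = cong (λ c → 1 * (c * monomial 1 α))
                                 (coeffα≡partitionsOfType n α (≡ᵇ⇒≡ _ n (subst T (sym weight≡ᵇn) _)))

    k!*bellℕ≡compositions : ∀ n k → k ! * bellℕ n k ≡ compositions 1 k n
    k!*bellℕ≡compositions n k = trans (cong (k ! *_) (bellℕ≡typeSum n k))
      (k!*typeSum≡compositions (n ∸ k + 1) 0 k n k ≤-refl n<n∸k+1+k)
      where
      n<n∸k+1+k : n < n ∸ k + 1 + k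
      n<n∸k+1+k = subst (n <_) (rearrange k (n ∸ k)) (s≤s (m≤n+m∸n n k))
        where
        rearrange : ∀ k d → suc (k + d) ≡ d + 1 + k
        rearrange = solve-∀

  -- Colourings of complete graphs

  module _ (y : ℕ → ℕ) where

    convolutionPower : ℕ → ℕ → ℕ
    convolutionPower zero    n = 𝟙 (n ≡ᵇ 0)
    convolutionPower (suc l) n = Σ< (suc n) (λ j → (n C j) * (y j * convolutionPower l (n ∸ j)))

    y≡𝟙[0≡ᵇj]+blockWeight : y 0 ≡ 1 → ∀ j → y j ≡ 𝟙 (0 ≡ᵇ j) + blockWeight y 1 j
    y≡𝟙[0≡ᵇj]+blockWeight y0≡1 j = begin
      y j                                    ≡⟨ sym (*-identityˡ (y j)) ⟩
      blockWeight y 0 j                      ≡⟨ blockWeight-split y 0 j ⟩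
      𝟙 (0 ≡ᵇ j) * y 0 + blockWeight y 1 j   ≡⟨ cong (λ z → 𝟙 (0 ≡ᵇ j) * z + blockWeight y 1 j) y0≡1 ⟩
      𝟙 (0 ≡ᵇ j) * 1 + blockWeight y 1 j     ≡⟨ cong (_+ blockWeight y 1 j) (*-identityʳ (𝟙 (0 ≡ᵇ j))) ⟩
      𝟙 (0 ≡ᵇ j) + blockWeight y 1 j         ∎

    UsedFactorsExpansion : ℕ → Set
    UsedFactorsExpansion l = ∀ n → convolutionPower l n ≡ Σ< (suc l) (λ k → (l C k) * compositions y 1 k n)

    first-factor-used : ∀ {l} → UsedFactorsExpansion l → ∀ n →
      Σ< (suc n) (λ j → (n C j) * (blockWeight y 1 j * convolutionPower l (n ∸ j))) ≡
      Σ< (suc l) (λ k → (l C k) * compositions y 1 (suc k) n)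
    first-factor-used {l} expansion n = begin
      Σ< (suc n) (λ j → (n C j) * (blockWeight y 1 j * convolutionPower l (n ∸ j)))
        ≡⟨ Σ<-cong′ (suc n) (λ j → cong (λ z → (n C j) * (blockWeight y 1 j * z)) (expansion (n ∸ j))) ⟩
      Σ< (suc n) (λ j → (n C j) * (blockWeight y 1 j * Σ< (suc l) (λ k → (l C k) * compositions y 1 k (n ∸ j))))
        ≡⟨ Σ<-cong′ (suc n) (λ j → *-*-distribˡ-Σ< (suc l) (n C j) (blockWeight y 1 j)
                                                    (λ k → (l C k) * compositions y 1 k (n ∸ j))) ⟩
      Σ< (suc n) (λ j → Σ< (suc l) (λ k → (n C j) * (blockWeight y 1 j * ((l C k) * compositions y 1 k (n ∸ j)))))
        ≡⟨ Σ<-cong′ (suc n) (λ j → Σ<-cong′ (suc l) (λ k →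
             regroup (n C j) (blockWeight y 1 j) (l C k) (compositions y 1 k (n ∸ j)))) ⟩
      Σ< (suc n) (λ j → Σ< (suc l) (λ k → (l C k) * term k j))
        ≡⟨ Σ<-comm (suc n) (suc l) (λ j k → (l C k) * term k j) ⟩
      Σ< (suc l) (λ k → Σ< (suc n) (λ j → (l C k) * term k j))
        ≡⟨ Σ<-cong′ (suc l) (λ k → *-distribˡ-Σ< (suc n) (l C k) (term k)) ⟩
      Σ< (suc l) (λ k → (l C k) * compositions y 1 (suc k) n) ∎
      where
      term : ℕ → ℕ → ℕ
      term k j = (n C j) * (blockWeight y 1 j * compositions y 1 k (n ∸ j))
      regroup : ∀ c b g h → c * (b * (g * h)) ≡ g * (c * (b * h))
      regroup = solve-∀

    -- Split off the first factor according to whether it contributes a block or not.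
    convolutionPower≡Σ-compositions : y 0 ≡ 1 → ∀ l → UsedFactorsExpansion l
    convolutionPower≡Σ-compositions y0≡1 zero    n = sym (trans (+-identityʳ _) (+-identityʳ _))
    convolutionPower≡Σ-compositions y0≡1 (suc l) n = begin
      convolutionPower (suc l) n
        ≡⟨ Σ<-cong′ (suc n) split ⟩
      Σ< (suc n) (λ j → 𝟙 (0 ≡ᵇ j) * ((n C j) * convolutionPower l (n ∸ j)) + used j)
        ≡⟨ Σ<-distrib-+ (suc n) (λ j → 𝟙 (0 ≡ᵇ j) * ((n C j) * convolutionPower l (n ∸ j))) used ⟩
      Σ< (suc n) (λ j → 𝟙 (0 ≡ᵇ j) * ((n C j) * convolutionPower l (n ∸ j))) + Σ< (suc n) used
        ≡⟨ cong₂ _+_ (Σ<-select (suc n) 0 (λ j → (n C j) * convolutionPower l (n ∸ j)) (λ ()))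
                     (first-factor-used {l} (convolutionPower≡Σ-compositions y0≡1 l) n) ⟩
      1 * convolutionPower l n + Σ< (suc l) (λ k → (l C k) * compositions y 1 (suc k) n)
        ≡⟨ cong (_+ Σ< (suc l) (λ k → (l C k) * compositions y 1 (suc k) n))
                (trans (*-identityˡ _) (convolutionPower≡Σ-compositions y0≡1 l n)) ⟩
      Σ< (suc l) (λ k → (l C k) * compositions y 1 k n) + Σ< (suc l) (λ k → (l C k) * compositions y 1 (suc k) n)
        ≡⟨ sym (Σ<-Pascal l (λ k → compositions y 1 k n)) ⟩
      Σ< (suc (suc l)) (λ k → (suc l C k) * compositions y 1 k n) ∎
      where
      used : ℕ → ℕ
      used j = (n C j) * (blockWeight y 1 j * convolutionPower l (n ∸ j))
      split : ∀ j → (n C j) * (y j * convolutionPower l (n ∸ j)) ≡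
                    𝟙 (0 ≡ᵇ j) * ((n C j) * convolutionPower l (n ∸ j)) + used j
      split j = trans (cong (λ z → (n C j) * (z * convolutionPower l (n ∸ j))) (y≡𝟙[0≡ᵇj]+blockWeight y0≡1 j))
                      (distrib (n C j) (𝟙 (0 ≡ᵇ j)) (blockWeight y 1 j) (convolutionPower l (n ∸ j)))
        where
        distrib : ∀ c d b e → c * ((d + b) * e) ≡ d * (c * e) + c * (b * e)
        distrib = solve-∀

  allᶠ : ∀ {n} → (Fin n → Bool) → Bool
  allᶠ {zero}  p = true
  allᶠ {suc n} p = p Fin.zero ∧ allᶠ (p ∘ Fin.suc)

  foldr-∧-tabulate : ∀ {A : Set} {n} (p : A → Bool) (f : Fin n → A) →
    foldr (λ v b → p v ∧ b) true (tabulate f) ≡ allᶠ (p ∘ f)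
  foldr-∧-tabulate {n = zero}  p f = refl
  foldr-∧-tabulate {n = suc n} p f = cong (p (f Fin.zero) ∧_) (foldr-∧-tabulate p (f ∘ Fin.suc))

  allᶠ-cong : ∀ {n} {p q : Fin n → Bool} → (∀ i → p i ≡ q i) → allᶠ p ≡ allᶠ q
  allᶠ-cong {zero}  p≡q = refl
  allᶠ-cong {suc n} p≡q = cong₂ _∧_ (p≡q Fin.zero) (allᶠ-cong (p≡q ∘ Fin.suc))

  T-allᶠ⁻ : ∀ {n} (p : Fin n → Bool) → T (allᶠ p) → ∀ i → T (p i)
  T-allᶠ⁻ p all Fin.zero    = proj₁ (Equivalence.to T-∧ all)
  T-allᶠ⁻ p all (Fin.suc i) = T-allᶠ⁻ (p ∘ Fin.suc) (proj₂ (Equivalence.to T-∧ all)) i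

  T-allᶠ⁺ : ∀ {n} (p : Fin n → Bool) → (∀ i → T (p i)) → T (allᶠ p)
  T-allᶠ⁺ {zero}  p _   = _
  T-allᶠ⁺ {suc n} p all = Equivalence.from T-∧ (all Fin.zero , T-allᶠ⁺ (p ∘ Fin.suc) (all ∘ Fin.suc))

  ⌊suc≟suc⌋ : ∀ {n} (u v : Fin n) → ⌊ Fin.suc u FinP.≟ Fin.suc v ⌋ ≡ ⌊ u FinP.≟ v ⌋
  ⌊suc≟suc⌋ u v = ⌊⌋-map′ (cong Fin.suc) FinP.suc-injective (u FinP.≟ v)

  ⌊b≟b⌋ : ∀ {l} (b : Fin l) → ⌊ b FinP.≟ b ⌋ ≡ true
  ⌊b≟b⌋ b = trans (isYes≗does (b FinP.≟ b)) (dec-true (b FinP.≟ b) refl)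

  ⌊a≟b⌋-≢ : ∀ {l} {a b : Fin l} → a ≢ b → ⌊ a FinP.≟ b ⌋ ≡ false
  ⌊a≟b⌋-≢ {a = a} {b} a≢b = trans (isYes≗does (a FinP.≟ b)) (dec-false (a FinP.≟ b) a≢b)

  suc-∑-others : ∀ {n} (q : Fin n → Bool) v → q v ≡ true →
    suc (∑ (λ u → 𝟙 (not ⌊ u FinP.≟ v ⌋ ∧ q u))) ≡ ∑ (𝟙 ∘ q)
  suc-∑-others q Fin.zero    qv≡true rewrite qv≡true = refl
  suc-∑-others q (Fin.suc v) qv≡true = begin
    suc (𝟙 (q Fin.zero) + ∑ (λ u → 𝟙 (not ⌊ Fin.suc u FinP.≟ Fin.suc v ⌋ ∧ q (Fin.suc u))))
      ≡⟨ sym (+-suc (𝟙 (q Fin.zero)) _) ⟩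
    𝟙 (q Fin.zero) + suc (∑ (λ u → 𝟙 (not ⌊ Fin.suc u FinP.≟ Fin.suc v ⌋ ∧ q (Fin.suc u))))
      ≡⟨ cong (λ z → 𝟙 (q Fin.zero) + suc z)
              (sum-cong-≗ (λ u → cong (λ d → 𝟙 (not d ∧ q (Fin.suc u))) (⌊suc≟suc⌋ u v))) ⟩
    𝟙 (q Fin.zero) + suc (∑ (λ u → 𝟙 (not ⌊ u FinP.≟ v ⌋ ∧ q (Fin.suc u))))
      ≡⟨ cong (𝟙 (q Fin.zero) +_) (suc-∑-others (q ∘ Fin.suc) v qv≡true) ⟩
    ∑ (𝟙 ∘ q) ∎

  module _ (m : ℕ) where

    -- Colourings of an n-set with l colours in which, for every colour b, s b plus the size of
    -- the class of b is at most m; counted colour by colour.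
    boundedColourings : (l : ℕ) → ℕ → (Fin l → ℕ) → ℕ
    boundedColourings zero    n s = 𝟙 (n ≡ᵇ 0)
    boundedColourings (suc l) n s =
      Σ< (suc n) (λ j → (n C j) * (𝟙 (s Fin.zero + j ≤ᵇ m) * boundedColourings l (n ∸ j) (s ∘ Fin.suc)))

    _+[_] : ∀ {l} → (Fin l → ℕ) → Fin l → (Fin l → ℕ)
    (s +[ a ]) b = s b + 𝟙 ⌊ a FinP.≟ b ⌋

    boundedColourings-cong : ∀ l n {s s′ : Fin l → ℕ} → (∀ b → s b ≡ s′ b) →
      boundedColourings l n s ≡ boundedColourings l n s′
    boundedColourings-cong zero    n s≡s′ = refl
    boundedColourings-cong (suc l) n s≡s′ = Σ<-cong′ (suc n) (λ j →
      cong₂ (λ z e → (n C j) * (𝟙 (z + j ≤ᵇ m) * e)) (s≡s′ Fin.zero) (boundedColourings-cong l (n ∸ j) (s≡s′ ∘ Fin.suc)))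

    NewVertexExpansion : ℕ → Set
    NewVertexExpansion l = ∀ n (s : Fin l → ℕ) → boundedColourings l (suc n) s ≡ ∑ (λ a → boundedColourings l n (s +[ a ]))

    new-vertex-not-first-colour : ∀ {l} → NewVertexExpansion l → ∀ n (s : Fin (suc l) → ℕ) →
      ∑ (λ a → boundedColourings (suc l) n (s +[ Fin.suc a ])) ≡
      Σ< (suc n) (λ j → (n C j) * (𝟙 (s Fin.zero + j ≤ᵇ m) * boundedColourings l (suc n ∸ j) (s ∘ Fin.suc)))
    new-vertex-not-first-colour {l} expansion n s = begin
      ∑ (λ a → boundedColourings (suc l) n (s +[ Fin.suc a ]))
        ≡⟨ sum-cong-≗ (λ a → Σ<-cong′ (suc n) (λ j → cong₂ (λ z e → (n C j) * (𝟙 (z + j ≤ᵇ m) * e))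
             (+-identityʳ (s Fin.zero))
             (boundedColourings-cong l (n ∸ j) (λ b → cong (λ d → s′ b + 𝟙 d) (⌊suc≟suc⌋ a b))))) ⟩
      ∑ (λ a → Σ< (suc n) (λ j → (n C j) * (firstFits j * boundedColourings l (n ∸ j) (s′ +[ a ]))))
        ≡⟨ ∑-comm {l} {suc n} (λ a j → (n C toℕ j) * (firstFits (toℕ j) * boundedColourings l (n ∸ toℕ j) (s′ +[ a ]))) ⟩
      Σ< (suc n) (λ j → ∑ (λ a → (n C j) * (firstFits j * boundedColourings l (n ∸ j) (s′ +[ a ]))))
        ≡⟨ Σ<-cong (suc n) (λ j j<1+n → begin
             ∑ (λ a → (n C j) * (firstFits j * boundedColourings l (n ∸ j) (s′ +[ a ])))
               ≡⟨ sym (*-distribˡ-sum {l} (n C j) (λ a → firstFits j * boundedColourings l (n ∸ j) (s′ +[ a ]))) ⟩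
             (n C j) * ∑ (λ a → firstFits j * boundedColourings l (n ∸ j) (s′ +[ a ]))
               ≡⟨ cong ((n C j) *_) (sym (*-distribˡ-sum {l} (firstFits j) (λ a → boundedColourings l (n ∸ j) (s′ +[ a ])))) ⟩
             (n C j) * (firstFits j * ∑ (λ a → boundedColourings l (n ∸ j) (s′ +[ a ])))
               ≡⟨ cong (λ e → (n C j) * (firstFits j * e)) (sym (expansion (n ∸ j) s′)) ⟩
             (n C j) * (firstFits j * boundedColourings l (suc (n ∸ j)) s′)
               ≡⟨ cong (λ k → (n C j) * (firstFits j * boundedColourings l k s′)) (sym (+-∸-assoc 1 (≤-pred j<1+n))) ⟩
             (n C j) * (firstFits j * boundedColourings l (suc n ∸ j) s′) ∎) ⟩
      Σ< (suc n) (λ j → (n C j) * (firstFits j * boundedColourings l (suc n ∸ j) s′)) ∎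
      where
      s′ : Fin l → ℕ
      s′ = s ∘ Fin.suc
      firstFits : ℕ → ℕ
      firstFits j = 𝟙 (s Fin.zero + j ≤ᵇ m)

    -- Pascal's rule separates the new vertex having the first colour or not.
    boundedColourings-suc : ∀ l → NewVertexExpansion l
    boundedColourings-suc zero    n s = refl
    boundedColourings-suc (suc l) n s = begin
      Σ< (suc (suc n)) (λ j → (suc n C j) * X j)
        ≡⟨ Σ<-Pascal n X ⟩
      Σ< (suc n) (λ j → (n C j) * X j) + Σ< (suc n) (λ j → (n C j) * X (suc j))
        ≡⟨ +-comm (Σ< (suc n) (λ j → (n C j) * X j)) _ ⟩
      Σ< (suc n) (λ j → (n C j) * X (suc j)) + Σ< (suc n) (λ j → (n C j) * X j)
        ≡⟨ cong₂ _+_ (sym first-colour) (sym (new-vertex-not-first-colour {l} (boundedColourings-suc l) n s)) ⟩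
      boundedColourings (suc l) n (s +[ Fin.zero ]) + ∑ (λ a → boundedColourings (suc l) n (s +[ Fin.suc a ])) ∎
      where
      X : ℕ → ℕ
      X j = 𝟙 (s Fin.zero + j ≤ᵇ m) * boundedColourings l (suc n ∸ j) (s ∘ Fin.suc)
      first-colour : boundedColourings (suc l) n (s +[ Fin.zero ]) ≡ Σ< (suc n) (λ j → (n C j) * X (suc j))
      first-colour = Σ<-cong′ (suc n) (λ j → cong₂ (λ z e → (n C j) * (𝟙 (z ≤ᵇ m) * e))
        (+-assoc (s Fin.zero) 1 j) (boundedColourings-cong l (n ∸ j) (λ b → +-identityʳ (s (Fin.suc b)))))

    classSize : ∀ {n l} → (Fin n → Fin l) → Fin l → ℕ
    classSize c b = ∑ (λ u → 𝟙 ⌊ c u FinP.≟ b ⌋)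

    fits : ∀ {n l} → (Fin l → ℕ) → (Fin n → Fin l) → Bool
    fits s c = allᶠ (λ b → s b + classSize c b ≤ᵇ m)

    fittingColourings : ∀ {l} → (Fin l → ℕ) → ℕ → ℕ
    fittingColourings {l} s n = ∑∈ (allColourings n l) (𝟙 ∘ fits s)

    ∑∈-allColourings : ∀ n l (f : (Fin (suc n) → Fin l) → ℕ) →
      ∑∈ (allColourings (suc n) l) f ≡ ∑∈ (allColourings n l) (λ c → ∑ (λ a → f (extend a c)))
    ∑∈-allColourings n l f = trans
      (∑∈-concatMap (λ c → map (λ a → extend a c) (allFin l)) (allColourings n l) f)
      (∑∈-cong (allColourings n l) (λ c → trans (∑∈-map (λ a → extend a c) (allFin l) f)
                                                (∑∈-tabulate {n = l} (λ a → a) (λ a → f (extend a c)))))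

    fittingColourings-suc : ∀ {l} (s : Fin l → ℕ) n →
      fittingColourings s (suc n) ≡ ∑ (λ a → fittingColourings (s +[ a ]) n)
    fittingColourings-suc {l} s n = begin
      ∑∈ (allColourings (suc n) l) (𝟙 ∘ fits s)
        ≡⟨ ∑∈-allColourings n l (𝟙 ∘ fits s) ⟩
      ∑∈ (allColourings n l) (λ c → ∑ (λ a → 𝟙 (fits s (extend a c))))
        ≡⟨ ∑∈-cong (allColourings n l) (λ c → sum-cong-≗ (λ a → cong 𝟙 (allᶠ-cong (λ b →
             cong (_≤ᵇ m) (sym (+-assoc (s b) (𝟙 ⌊ a FinP.≟ b ⌋) (classSize c b))))))) ⟩
      ∑∈ (allColourings n l) (λ c → ∑ (λ a → 𝟙 (fits (s +[ a ]) c)))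
        ≡⟨ ∑∈-∑-comm (allColourings n l) (λ c a → 𝟙 (fits (s +[ a ]) c)) ⟩
      ∑ (λ a → fittingColourings (s +[ a ]) n) ∎

    boundedColourings-zero : ∀ l (s : Fin l → ℕ) → boundedColourings l 0 s ≡ 𝟙 (allᶠ (λ b → s b + 0 ≤ᵇ m))
    boundedColourings-zero zero    s = refl
    boundedColourings-zero (suc l) s = begin
      1 * (𝟙 (s Fin.zero + 0 ≤ᵇ m) * boundedColourings l 0 (s ∘ Fin.suc)) + 0
        ≡⟨ trans (+-identityʳ _) (*-identityˡ _) ⟩
      𝟙 (s Fin.zero + 0 ≤ᵇ m) * boundedColourings l 0 (s ∘ Fin.suc)
        ≡⟨ cong (𝟙 (s Fin.zero + 0 ≤ᵇ m) *_) (boundedColourings-zero l (s ∘ Fin.suc)) ⟩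
      𝟙 (s Fin.zero + 0 ≤ᵇ m) * 𝟙 (allᶠ (λ b → s (Fin.suc b) + 0 ≤ᵇ m))
        ≡⟨ sym (𝟙-∧ (s Fin.zero + 0 ≤ᵇ m) _) ⟩
      𝟙 (allᶠ (λ b → s b + 0 ≤ᵇ m)) ∎

    fittingColourings≡boundedColourings : ∀ l n (s : Fin l → ℕ) → fittingColourings s n ≡ boundedColourings l n s
    fittingColourings≡boundedColourings l zero    s = trans (+-identityʳ _) (sym (boundedColourings-zero l s))
    fittingColourings≡boundedColourings l (suc n) s = begin
      fittingColourings s (suc n)
        ≡⟨ fittingColourings-suc s n ⟩
      ∑ (λ a → fittingColourings (s +[ a ]) n)
        ≡⟨ sum-cong-≗ (λ a → fittingColourings≡boundedColourings l n (s +[ a ])) ⟩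
      ∑ (λ a → boundedColourings l n (s +[ a ]))
        ≡⟨ sym (boundedColourings-suc l n s) ⟩
      boundedColourings l (suc n) s ∎

    1+monoDeg≡classSize : ∀ {n l} (c : Fin n → Fin l) v → suc (monoDeg (complete n) c v) ≡ classSize c (c v)
    1+monoDeg≡classSize {n} c v = trans
      (cong suc (trans (length-filterᵇ _ (allFin n))
                       (∑∈-tabulate {n = n} (λ u → u) (λ u → 𝟙 (not ⌊ u FinP.≟ v ⌋ ∧ ⌊ c u FinP.≟ c v ⌋)))))
      (suc-∑-others (λ u → ⌊ c u FinP.≟ c v ⌋) v (⌊b≟b⌋ (c v)))

    classSize-unused : ∀ {n l} (c : Fin n → Fin l) b → (∀ u → c u ≢ b) → classSize c b ≡ 0
    classSize-unused {n} c b unused = trans (sum-cong-≗ (λ u → cong 𝟙 (⌊a≟b⌋-≢ (unused u)))) (sum-replicate-zero n)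

    isGood≡fits : ∀ {n l} (c : Fin n → Fin l) → isGood m (complete n) c ≡ fits (λ _ → 0) c
    isGood≡fits {n} c =
      trans (foldr-∧-tabulate (λ v → monoDeg (complete n) c v <ᵇ m) (λ v → v)) (T-injective good⇒fits fits⇒good)
      where
      good-at : ∀ v → (monoDeg (complete n) c v <ᵇ m) ≡ (classSize c (c v) ≤ᵇ m)
      good-at v = cong (_≤ᵇ m) (1+monoDeg≡classSize c v)
      good⇒fits : T (allᶠ (λ v → monoDeg (complete n) c v <ᵇ m)) → T (fits (λ _ → 0) c)
      good⇒fits good = T-allᶠ⁺ _ fits-at
        where
        fits-at : ∀ b → T (classSize c b ≤ᵇ m)
        fits-at b with FinP.any? (λ v → c v FinP.≟ b)
        ... | yes (v , refl) = subst T (good-at v) (T-allᶠ⁻ _ good v)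
        ... | no  unused     = subst (λ z → T (z ≤ᵇ m)) (sym (classSize-unused c b (λ u cu≡b → unused (u , cu≡b)))) _
      fits⇒good : T (fits (λ _ → 0) c) → T (allᶠ (λ v → monoDeg (complete n) c v <ᵇ m))
      fits⇒good fits = T-allᶠ⁺ _ (λ v → subst T (sym (good-at v)) (T-allᶠ⁻ _ fits (c v)))

    boundedColourings≡convolutionPower : ∀ l n → boundedColourings l n (λ _ → 0) ≡ convolutionPower (λ j → 𝟙 (j ≤ᵇ m)) l n
    boundedColourings≡convolutionPower zero    n = refl
    boundedColourings≡convolutionPower (suc l) n = Σ<-cong′ (suc n) (λ j →
      cong (λ e → (n C j) * (𝟙 (j ≤ᵇ m) * e)) (boundedColourings≡convolutionPower l (n ∸ j)))

    χ≡convolutionPower : ∀ n l → χ m (complete n) l ≡ convolutionPower (λ j → 𝟙 (j ≤ᵇ m)) l n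
    χ≡convolutionPower n l = begin
      length (filterᵇ (isGood m (complete n)) (allColourings n l))
        ≡⟨ length-filterᵇ (isGood m (complete n)) (allColourings n l) ⟩
      ∑∈ (allColourings n l) (𝟙 ∘ isGood m (complete n))
        ≡⟨ ∑∈-cong (allColourings n l) (cong 𝟙 ∘ isGood≡fits) ⟩
      fittingColourings (λ _ → 0) n
        ≡⟨ fittingColourings≡boundedColourings l n (λ _ → 0) ⟩
      boundedColourings l n (λ _ → 0)
        ≡⟨ boundedColourings≡convolutionPower l n ⟩
      convolutionPower (λ j → 𝟙 (j ≤ᵇ m)) l n ∎

  χ-complete≡Σ-bellℕ : ∀ m n l → 1 ≤ n →
    χ m (complete n) l ≡ Σ< n (λ k → bellℕ (λ j → 𝟙 (j ≤ᵇ m)) n (suc k) * ((l C suc k) * suc k !))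
  χ-complete≡Σ-bellℕ m n@(suc _) l _ = begin
    χ m (complete n) l
      ≡⟨ χ≡convolutionPower m n l ⟩
    convolutionPower x l n
      ≡⟨ convolutionPower≡Σ-compositions x refl l n ⟩
    Σ< l (λ k → (l C suc k) * compositions x 1 (suc k) n)
      ≡⟨ Σ<-support l n (λ k → (l C suc k) * compositions x 1 (suc k) n)
           (λ k l≤k → cong (_* compositions x 1 (suc k) n) (k>n⇒nCk≡0 (s≤s l≤k)))
           (λ k n≤k → trans (cong ((l C suc k) *_) (compositions-vanish x 1 (suc k) n (n<1*[1+k] n≤k))) (*-zeroʳ (l C suc k))) ⟩
    Σ< n (λ k → (l C suc k) * compositions x 1 (suc k) n)
      ≡⟨ Σ<-cong′ n (λ k → trans (cong ((l C suc k) *_) (sym (k!*bellℕ≡compositions x n (suc k))))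
                                (regroup (l C suc k) (suc k !) (bellℕ x n (suc k)))) ⟩
    Σ< n (λ k → bellℕ x n (suc k) * ((l C suc k) * suc k !)) ∎
    where
    x : ℕ → ℕ
    x j = 𝟙 (j ≤ᵇ m)
    n<1*[1+k] : ∀ {k} → n ≤ k → n < 1 * suc k
    n<1*[1+k] {k} n≤k = subst (n <_) (sym (*-identityˡ (suc k))) (s≤s n≤k)
    regroup : ∀ c f b → c * (f * b) ≡ b * (c * f)
    regroup = solve-∀


open Counting

open import Data.Bool using (Bool; true; false)
open import Data.Integer using (ℤ; +_; -_; _+_; _-_; _*_; _^_)
import Data.Integer.Properties as ℤ
open import Data.Integer.Tactic.RingSolver using (solve-∀)
open import Data.List using ([]; _∷_; map; foldr; filterᵇ)
open import Data.Nat as ℕ using (ℕ; zero; suc; _≤_; _∸_; _!)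
import Data.Nat.Properties as ℕ
open import Data.Nat.Combinatorics using (_C_; k>n⇒nCk≡0)
open import Data.Product using (Σ; _×_; _,_)
open import Function using (_∘_)
open import Relation.Binary.PropositionalEquality
open import Relation.Nullary using (yes; no)
open ≡-Reasoning

-- Polynomials and falling factorials

infixl 6 _+ₚ_
infixr 7 _·ₚ_

_+ₚ_ : Poly → Poly → Poly
[]      +ₚ q       = q
(a ∷ p) +ₚ []      = a ∷ p
(a ∷ p) +ₚ (b ∷ q) = (a + b) ∷ (p +ₚ q)

_·ₚ_ : ℤ → Poly → Poly
c ·ₚ p = map (c *_) p

eval-+ₚ : ∀ p q x → eval (p +ₚ q) x ≡ eval p x + eval q x
eval-+ₚ []      q       x = sym (ℤ.+-identityˡ (eval q x))
eval-+ₚ (a ∷ p) []      x = sym (ℤ.+-identityʳ _)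
eval-+ₚ (a ∷ p) (b ∷ q) x = trans (cong (λ z → (a + b) + x * z) (eval-+ₚ p q x)) (regroup a b x (eval p x) (eval q x))
  where
  regroup : ∀ a b x p q → (a + b) + x * (p + q) ≡ (a + x * p) + (b + x * q)
  regroup = solve-∀

eval-·ₚ : ∀ c p x → eval (c ·ₚ p) x ≡ c * eval p x
eval-·ₚ c []      x = sym (ℤ.*-zeroʳ c)
eval-·ₚ c (a ∷ p) x = trans (cong (λ z → c * a + x * z) (eval-·ₚ c p x)) (regroup c a x (eval p x))
  where
  regroup : ∀ c a x p → c * a + x * (c * p) ≡ c * (a + x * p)
  regroup = solve-∀

sumFrom1ₚ : ℕ → (ℕ → Poly) → Poly
sumFrom1ₚ zero    f = []
sumFrom1ₚ (suc n) f = sumFrom1ₚ n f +ₚ f (suc n)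

eval-sumFrom1ₚ : ∀ n f x → eval (sumFrom1ₚ n f) x ≡ sumFrom1 n (λ k → eval (f k) x)
eval-sumFrom1ₚ zero    f x = refl
eval-sumFrom1ₚ (suc n) f x = trans (eval-+ₚ (sumFrom1ₚ n f) (f (suc n)) x) (cong (_+ eval (f (suc n)) x) (eval-sumFrom1ₚ n f x))

sumFrom1-cong : ∀ n {f g : ℕ → ℤ} → (∀ k → f k ≡ g k) → sumFrom1 n f ≡ sumFrom1 n g
sumFrom1-cong zero    f≡g = refl
sumFrom1-cong (suc n) f≡g = cong₂ _+_ (sumFrom1-cong n f≡g) (f≡g (suc n))

sumFrom1-+ : ∀ n (h : ℕ → ℕ) → sumFrom1 n (λ k → + h k) ≡ + Σ< n (h ∘ suc)
sumFrom1-+ zero    h = refl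
sumFrom1-+ (suc n) h = trans (cong (λ z → z + + h (suc n)) (sumFrom1-+ n h)) (cong +_ (sym (Σ<-init-last n (h ∘ suc))))

falling : ℤ → ℕ → ℤ
falling x zero    = + 1
falling x (suc k) = (x - + k) * falling x k

fallingₚ : ℕ → Poly
fallingₚ zero    = + 1 ∷ []
fallingₚ (suc k) = (+ 0 ∷ fallingₚ k) +ₚ (- + k) ·ₚ fallingₚ k

eval-fallingₚ : ∀ k x → eval (fallingₚ k) x ≡ falling x k
eval-fallingₚ zero    x = cong (λ z → + 1 + z) (ℤ.*-zeroʳ x)
eval-fallingₚ (suc k) x = begin
  eval ((+ 0 ∷ fallingₚ k) +ₚ (- + k) ·ₚ fallingₚ k) x
    ≡⟨ eval-+ₚ (+ 0 ∷ fallingₚ k) ((- + k) ·ₚ fallingₚ k) x ⟩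
  (+ 0 + x * eval (fallingₚ k) x) + eval ((- + k) ·ₚ fallingₚ k) x
    ≡⟨ cong (λ z → (+ 0 + x * eval (fallingₚ k) x) + z) (eval-·ₚ (- + k) (fallingₚ k) x) ⟩
  (+ 0 + x * eval (fallingₚ k) x) + - + k * eval (fallingₚ k) x
    ≡⟨ factor x (+ k) (eval (fallingₚ k) x) ⟩
  (x - + k) * eval (fallingₚ k) x
    ≡⟨ cong ((x - + k) *_) (eval-fallingₚ k x) ⟩
  falling x (suc k) ∎
  where
  factor : ∀ x k e → (+ 0 + x * e) + - k * e ≡ (x - k) * e
  factor = solve-∀

falling-+ : ∀ l k → falling (+ l) k ≡ + ((l C k) ℕ.* k !)
falling-+ l zero    = refl
falling-+ l (suc k) with k ℕ.≤? l
... | yes k≤l = begin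
  (+ l - + k) * falling (+ l) k
    ≡⟨ cong₂ _*_ (trans (ℤ.[+m]-[+n]≡m⊖n l k) (ℤ.⊖-≥ k≤l)) (falling-+ l k) ⟩
  + (l ∸ k) * + ((l C k) ℕ.* k !)
    ≡⟨ sym (ℤ.pos-* (l ∸ k) ((l C k) ℕ.* k !)) ⟩
  + ((l ∸ k) ℕ.* ((l C k) ℕ.* k !))
    ≡⟨ cong +_ ([n∸k]*[nCk*k!]≡nC[1+k]*[1+k]! l k) ⟩
  + ((l C suc k) ℕ.* suc k !) ∎
... | no k≰l = begin
  (+ l - + k) * falling (+ l) k
    ≡⟨ cong ((+ l - + k) *_) (trans (falling-+ l k) (cong (λ c → + (c ℕ.* k !)) (k>n⇒nCk≡0 (ℕ.≰⇒> k≰l)))) ⟩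
  (+ l - + k) * + 0
    ≡⟨ ℤ.*-zeroʳ (+ l - + k) ⟩
  + 0
    ≡⟨ cong (λ c → + (c ℕ.* suc k !)) (sym (k>n⇒nCk≡0 (ℕ.m<n⇒m<1+n (ℕ.≰⇒> k≰l)))) ⟩
  + ((l C suc k) ℕ.* suc k !) ∎

falling-[-1] : ∀ k → falling (- (+ 1)) k ≡ sign k * + (k !)
falling-[-1] zero    = refl
falling-[-1] (suc k) = begin
  (- (+ 1) - + k) * falling (- (+ 1)) k
    ≡⟨ cong ((- (+ 1) - + k) *_) (falling-[-1] k) ⟩
  (- (+ 1) - + k) * (sign k * + (k !))
    ≡⟨ regroup (+ k) (+ (k !)) (sign k) ⟩
  (- (+ 1) * sign k) * (+ (k !) + + k * + (k !))
    ≡⟨ cong ((- (+ 1) * sign k) *_) (sym (trans (ℤ.pos-+ (k !) (k ℕ.* k !)) (cong (λ z → + (k !) + z) (ℤ.pos-* k (k !))))) ⟩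
  sign (suc k) * + (suc k !) ∎
  where
  regroup : ∀ K F s → (- (+ 1) - K) * (s * F) ≡ (- (+ 1) * s) * (F + K * F)
  regroup = solve-∀

+m^a≡+[m^a] : ∀ m a → (+ m) ^ a ≡ + (m ℕ.^ a)
+m^a≡+[m^a] m zero    = refl
+m^a≡+[m^a] m (suc a) = trans (cong (+ m *_) (+m^a≡+[m^a] m a)) (sym (ℤ.pos-* m (m ℕ.^ a)))

monoFrom≡+monomial : ∀ {y : ℕ → ℤ} {x : ℕ → ℕ} → (∀ i → y i ≡ + x i) →
  ∀ i α → monoFrom i y α ≡ + monomial x i α
monoFrom≡+monomial         y≡x i []      = refl
monoFrom≡+monomial {y} {x} y≡x i (a ∷ α) = begin
  y i ^ a * monoFrom (suc i) y α
    ≡⟨ cong₂ _*_ (trans (cong (_^ a) (y≡x i)) (+m^a≡+[m^a] (x i) a)) (monoFrom≡+monomial y≡x (suc i) α) ⟩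
  + (x i ℕ.^ a) * + monomial x (suc i) α
    ≡⟨ sym (ℤ.pos-* (x i ℕ.^ a) (monomial x (suc i) α)) ⟩
  + monomial x i (a ∷ α) ∎

foldr-+-map-filterᵇ : {A : Set} (P : A → Bool) {h : A → ℤ} {g : A → ℕ} → (∀ α → h α ≡ + g α) →
  ∀ xs → foldr _+_ (+ 0) (map h (filterᵇ P xs)) ≡ + ∑∈ xs (λ α → 𝟙 (P α) ℕ.* g α)
foldr-+-map-filterᵇ P h≡g []       = refl
foldr-+-map-filterᵇ P {h} {g} h≡g (α ∷ xs) with P α
... | true  = trans (cong₂ _+_ (h≡g α) (foldr-+-map-filterᵇ P h≡g xs))
                    (cong (λ z → + (z ℕ.+ ∑∈ xs (λ β → 𝟙 (P β) ℕ.* g β))) (sym (ℕ.+-identityʳ (g α))))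
... | false = foldr-+-map-filterᵇ P h≡g xs

bell≡+bellℕ : ∀ {y : ℕ → ℤ} {x : ℕ → ℕ} → (∀ i → y i ≡ + x i) → ∀ n k → bell n k y ≡ + bellℕ x n k
bell≡+bellℕ {y} {x} y≡x n k = foldr-+-map-filterᵇ _
  (λ α → trans (cong (+ coeffα n α *_) (monoFrom≡+monomial y≡x 1 α)) (sym (ℤ.pos-* (coeffα n α) (monomial x 1 α))))
  (boundedSeqs (n ∸ k ℕ.+ 1) k)

one≡+𝟙 : ∀ m i → one m i ≡ + 𝟙 (i ℕ.≤ᵇ m)
one≡+𝟙 m i with i ℕ.≤ᵇ m
... | true  = refl
... | false = refl

chromaticₚ : ℕ → ℕ → Poly
chromaticₚ m n = sumFrom1ₚ n (λ k → bell n k (one m) ·ₚ fallingₚ k)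

eval-chromaticₚ : ∀ m n x → eval (chromaticₚ m n) x ≡ sumFrom1 n (λ k → bell n k (one m) * falling x k)
eval-chromaticₚ m n x = trans (eval-sumFrom1ₚ n (λ k → bell n k (one m) ·ₚ fallingₚ k) x)
  (sumFrom1-cong n (λ k → trans (eval-·ₚ (bell n k (one m)) (fallingₚ k) x) (cong (bell n k (one m) *_) (eval-fallingₚ k x))))

eval-chromaticₚ-+ : ∀ m n l → 1 ≤ n → eval (chromaticₚ m n) (+ l) ≡ + χ m (complete n) l
eval-chromaticₚ-+ m n l 1≤n = begin
  eval (chromaticₚ m n) (+ l)
    ≡⟨ eval-chromaticₚ m n (+ l) ⟩
  sumFrom1 n (λ k → bell n k (one m) * falling (+ l) k)
    ≡⟨ sumFrom1-cong n (λ k → trans (cong₂ _*_ (bell≡+bellℕ (one≡+𝟙 m) n k) (falling-+ l k))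
                                    (sym (ℤ.pos-* (bellℕ x n k) ((l C k) ℕ.* k !)))) ⟩
  sumFrom1 n (λ k → + (bellℕ x n k ℕ.* ((l C k) ℕ.* k !)))
    ≡⟨ sumFrom1-+ n (λ k → bellℕ x n k ℕ.* ((l C k) ℕ.* k !)) ⟩
  + Σ< n (λ k → bellℕ x n (suc k) ℕ.* ((l C suc k) ℕ.* suc k !))
    ≡⟨ cong +_ (sym (χ-complete≡Σ-bellℕ m n l 1≤n)) ⟩
  + χ m (complete n) l ∎
  where
  x : ℕ → ℕ
  x i = 𝟙 (i ℕ.≤ᵇ m)

eval-chromaticₚ-[-1] : ∀ m n → eval (chromaticₚ m n) (- (+ 1)) ≡ sumFrom1 n (λ k → sign k * + (k !) * bell n k (one m))
eval-chromaticₚ-[-1] m n = trans (eval-chromaticₚ m n (- (+ 1)))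
  (sumFrom1-cong n (λ k → trans (cong (bell n k (one m) *_) (falling-[-1] k)) (ℤ.*-comm (bell n k (one m)) _)))

corollary1 : (m n : ℕ) → 1 ≤ m → 1 ≤ n →
  Σ Poly (λ p →
    ((l : ℕ) → 1 ≤ l → eval p (+ l) ≡ + χ m (complete n) l)
    × eval p (- (+ 1)) ≡ sumFrom1 n (λ k → sign k * + (k !) * bell n k (one m)))
corollary1 m n _ 1≤n = chromaticₚ m n , (λ l _ → eval-chromaticₚ-+ m n l 1≤n) , eval-chromaticₚ-[-1] m n
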